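{- Let $A$ be a nonempty finite set and let $(\mathcal P,\mathcal S)$ be a scenario on $A$. If $(\mathcal P,\mathcal S)$ has a tree decomposition, then $(\mathcal P,\mathcal S)$ has a branch decomposition.
   Context: A partition of $A$ is a set of pairwise disjoint subsets of $A$ (empty sets allowed) with union $A$; $\textup{Part}(A)$ is the set of partitions. $P_1$ is coarser than $P_2$ if every set of $P_1$ is a union of sets of $P_2$. $X^c=A\setminus X$. A scenario on $A$ is a pair $(\mathcal P,\mathcal S)$, $\mathcal P\subseteq\textup{Part}(A)$, $\mathcal S\subseteq 2^A$, with: (SC1) $\mathcal P$ closed under coarser partitions; (SC2) if $X\subseteq S\in\mathcal S$ and $X\in P$ for some $P\in\mathcal P$ then $X\in\mathcal S$; (SC3) $\{S,S^c\}\in\mathcal P$ for all $S\in\mathcal S$. A tree is a nonempty connected acyclic graph; $L(T)$ is its set of leaves (nodes of degree at most one). A tree decomposition of $(\mathcal P,\mathcal S)$ is a pair $(T,\tau)$, $\tau:L(T)\to\mathcal S$, such that $\tau(L(T))$ is a partition of $A$ and for each internal node $t$, $P_t:=\{\bigcup\tau(L(T)\cap V(T'))\mid T'\text{ a component of }T-t\}\in\mathcal P$. A tree is cubic if every internal node has degree $3$. A branch decomposition of $(\mathcal P,\mathcal S)$ is a pair $(T,\beta)$ with $T$ a cubic tree and $\beta:L(T)\to\mathcal S$ such that $\beta(L(T))$ is a partition of $A$ and for every edge $e$ of $T$, with $T_1,T_2$ the two components of $T-e$, the pair $P_e:=\{\bigcup\beta(L(T)\cap V(T_1)),\bigcup\beta(L(T)\cap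 V(T_2))\}$ belongs to $\mathcal P$. -}

module Defs where

open import Data.Nat using (ℕ; zero; suc; _≤_)
open import Data.Fin using (Fin)
open import Data.Fin.Subset using (Subset; _∈_; _∉_; _⊆_; ∁; ∣_∣)
open import Data.List using (List; _∷_; []; _++_; [_]; length)
open import Data.List.Relation.Unary.Linked using (Linked)
open import Data.List.Relation.Unary.Unique.Propositional using (Unique)
open import Data.Product using (Σ; Σ-syntax; _×_; _,_)
open import Data.Sum using (_⊎_)
open import Data.Empty using (⊥)
open import Relation.Nullary using (¬_)
open import Relation.Binary.PropositionalEquality using (_≡_; _≢_)
open import Function.Bundles using (_⇔_)

-- The ground set A is Fin n; subsets of A are Data.Fin.Subset n.
-- A (possibly infinite-description) set of subsets of A is a predicate.

Family : ℕ → Set₁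
Family n = Subset n → Set

_≈F_ : ∀ {n} → Family n → Family n → Set
F ≈F G = ∀ Z → F Z ⇔ G Z

pairF : ∀ {n} → Subset n → Subset n → Family n
pairF X Y Z = (Z ≡ X) ⊎ (Z ≡ Y)

InUnion : ∀ {n} → Family n → Fin n → Set
InUnion F a = Σ[ Z ∈ Subset _ ] (F Z × a ∈ Z)

-- F is a partition of A: pairwise disjoint members (empty sets allowed)
-- whose union is A
IsPartition : ∀ {n} → Family n → Set
IsPartition {n} F =
  (∀ X Y → F X → F Y → X ≢ Y → ∀ (a : Fin n) → a ∈ X → a ∈ Y → ⊥)
  × (∀ (a : Fin n) → InUnion F a)

Coarser : ∀ {n} → Family n → Family n → Set₁
Coarser {n} P₁ P₂ =
  ∀ X → P₁ X →
    Σ[ 𝒴 ∈ Family n ] ((∀ Z → 𝒴 Z → P₂ Z) × (∀ a → (a ∈ X) ⇔ InUnion 𝒴 a))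

_∈𝒫_ : ∀ {n} → Family n → (Family n → Set) → Set₁
F ∈𝒫 𝒫 = Σ[ P ∈ Family _ ] (𝒫 P × P ≈F F)

record IsScenario {n : ℕ} (𝒫 : Family n → Set) (𝒮 : Subset n → Set) : Set₁ where
  field
    partitions : ∀ P → 𝒫 P → IsPartition P
    SC1 : ∀ P Q → 𝒫 P → IsPartition Q → Coarser Q P → Q ∈𝒫 𝒫
    SC2 : ∀ X S P → 𝒮 S → X ⊆ S → 𝒫 P → P X → 𝒮 X
    SC3 : ∀ S → 𝒮 S → pairF S (∁ S) ∈𝒫 𝒫

-- Finite graphs on vertex set Fin m, given by neighbourhoods.

Graph : ℕ → Set
Graph m = Fin m → Subset m

Adj : ∀ {m} → Graph m → Fin m → Fin m → Set
Adj G u v = v ∈ G u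

data Reach {m : ℕ} (step : Fin m → Fin m → Set) : Fin m → Fin m → Set where
  here : ∀ {u} → Reach step u u
  there : ∀ {u v w} → step u v → Reach step v w → Reach step u w

Symmetric : ∀ {m} → Graph m → Set
Symmetric G = ∀ u v → Adj G u v → Adj G v u

Irreflexive : ∀ {m} → Graph m → Set
Irreflexive G = ∀ u → u ∉ G u

Connected : ∀ {m} → Graph m → Set
Connected G = ∀ u v → Reach (Adj G) u v

-- a cycle: distinct vertices v ∷ ws (at least 3), consecutive ones
-- adjacent, and the last adjacent to v
HasCycle : ∀ {m} → Graph m → Set
HasCycle {m} G =
  Σ[ v ∈ Fin m ] Σ[ ws ∈ List (Fin m) ]
    (2 ≤ length ws × Unique (v ∷ ws) × Linked (Adj G) (v ∷ ws ++ [ v ]))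

IsTree : ∀ {m} → Graph m → Set
IsTree {m} G = 1 ≤ m × Symmetric G × Irreflexive G × Connected G × ¬ HasCycle G

degree : ∀ {m} → Graph m → Fin m → ℕ
degree G t = ∣ G t ∣

IsLeaf : ∀ {m} → Graph m → Fin m → Set
IsLeaf G t = degree G t ≤ 1

IsCubic : ∀ {m} → Graph m → Set
IsCubic G = ∀ t → ¬ IsLeaf G t → degree G t ≡ 3

-- the image τ(L(T)) as a family of subsets of A
-- (τ is given as a function on all nodes; only its values on leaves matter)
leafImage : ∀ {m n} → Graph m → (Fin m → Subset n) → Family n
leafImage {m} G τ X = Σ[ ℓ ∈ Fin m ] (IsLeaf G ℓ × τ ℓ ≡ X)

StepAvoidNode : ∀ {m} → Graph m → Fin m → Fin m → Fin m → Set
StepAvoidNode G t x y = Adj G x y × x ≢ t × y ≢ t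

StepAvoidEdge : ∀ {m} → Graph m → Fin m → Fin m → Fin m → Fin m → Set
StepAvoidEdge G u v x y = Adj G x y × ¬ ((x ≡ u × y ≡ v) ⊎ (x ≡ v × y ≡ u))

-- the union of τ over the leaves reachable from w via the given steps
-- (i.e. over the leaves of the component containing w)
leafUnion : ∀ {m n} → Graph m → (Fin m → Fin m → Set) → (Fin m → Subset n)
            → Fin m → Fin n → Set
leafUnion {m} G step τ w a =
  Σ[ ℓ ∈ Fin m ] (IsLeaf G ℓ × Reach step w ℓ × a ∈ τ ℓ)

IsLeafUnion : ∀ {m n} → Graph m → (Fin m → Fin m → Set) → (Fin m → Subset n)
              → Fin m → Subset n → Set
IsLeafUnion G step τ w X = ∀ a → (a ∈ X) ⇔ leafUnion G step τ w a

-- P_t = { ⋃ τ(L(T) ∩ V(T')) | T' a component of T - t }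
-- (components of T - t are the classes of vertices w ≠ t under reachability in T - t)
P-node : ∀ {m n} → Graph m → (Fin m → Subset n) → Fin m → Family n
P-node {m} G τ t X =
  Σ[ w ∈ Fin m ] (w ≢ t × IsLeafUnion G (StepAvoidNode G t) τ w X)

-- P_e for the edge e = {u,v}: the components of T - e are those of u and of v
P-edge : ∀ {m n} → Graph m → (Fin m → Subset n) → Fin m → Fin m → Family n
P-edge G β u v X =
  IsLeafUnion G (StepAvoidEdge G u v) β u X ⊎ IsLeafUnion G (StepAvoidEdge G u v) β v X

record TreeDecomposition {n : ℕ} (𝒫 : Family n → Set) (𝒮 : Subset n → Set) : Set₁ where
  field
    m : ℕ
    T : Graph m
    τ : Fin m → Subset n
    tree : IsTree T
    leaves-in-𝒮 : ∀ ℓ → IsLeaf T ℓ → 𝒮 (τ ℓ)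
    leaves-partition : IsPartition (leafImage T τ)
    internal : ∀ t → ¬ IsLeaf T t → P-node T τ t ∈𝒫 𝒫

record BranchDecomposition {n : ℕ} (𝒫 : Family n → Set) (𝒮 : Subset n → Set) : Set₁ where
  field
    m : ℕ
    T : Graph m
    β : Fin m → Subset n
    tree : IsTree T
    cubic : IsCubic T
    leaves-in-𝒮 : ∀ ℓ → IsLeaf T ℓ → 𝒮 (β ℓ)
    leaves-partition : IsPartition (leafImage T β)
    edges : ∀ u v → Adj T u v → P-edge T β u v ∈𝒫 𝒫

module Submission where

-- Call S ⊆ A a cut if {S, Sᶜ} ∈ 𝒫.  A bracketing of A (a binary tree of
-- sets of 𝒮 partitioning A) whose brackets below the top are cuts yields a
-- branch decomposition: realised as a cubic tree given by parent pointers,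
-- each edge separates a bracket from its complement.  Such a bracketing is
-- built by rooting the decomposition tree T and bracketing, for a directed
-- edge v → c, the leaves of the component of T − v containing c: a leaf c
-- gives the cut τ(c) by (SC3); at an internal c the components of T − c
-- beyond c give blocks of P_c ∈ 𝒫, merged one at a time, so that each
-- partial union is a union of blocks and hence a cut by (SC1).  A block
-- already covered is skipped (P_c is a set, so components may share it).

open import Defs
open import Data.Nat using (ℕ; zero; suc; _+_; _≤_; _<_; z≤n; s≤s; _≤?_)
import Data.Nat.Properties as ℕₚ
open import Data.Fin using (Fin; zero; suc; toℕ; _↑ˡ_; _↑ʳ_; splitAt)
open import Data.Fin.Properties using (_≟_; toℕ-injective; toℕ<n; any?)
import Data.Fin.Properties as Finₚ
open import Data.Fin.Subset using (Subset; _∈_; _∉_; _⊆_; _∪_; ∁; ∣_∣; ⁅_⁆; inside; outside)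
import Data.Fin.Subset as Sub
import Data.Fin.Subset.Properties as Subₚ
open import Data.Bool using (Bool; true; false; _∧_; _∨_; if_then_else_) renaming (T to IsTrue)
open import Data.Bool.Properties using (T-∨; T-∧)
import Data.Bool.Properties as Boolₚ
open import Data.Vec using (tabulate; here; there; _∷_)
import Data.Vec.Properties as Vecₚ
open import Data.List using (List; []; _∷_; _++_; [_]; length; lookup; allFin)
open import Data.List.Relation.Unary.Linked using (Linked; []; [-]; _∷_)
import Data.List.Relation.Unary.Linked as Linked
open import Data.List.Relation.Unary.All using (All; []; _∷_)
open import Data.List.Relation.Unary.All.Properties using (¬Any⇒All¬)
import Data.List.Relation.Unary.All as All
open import Data.List.Relation.Unary.Any using (here; there)
open import Data.List.Relation.Unary.AllPairs using ([]; _∷_)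
open import Data.List.Relation.Unary.Unique.Propositional using (Unique)
import Data.List.Membership.Propositional as List
open import Data.List.Membership.Propositional.Properties using (∈-allFin)
open import Data.Product using (Σ-syntax; _×_; _,_; proj₁; proj₂)
open import Data.Sum using (_⊎_; inj₁; inj₂; [_,_]′)
open import Data.Sum.Function.Propositional using (_⊎-⇔_)
open import Data.Empty using (⊥; ⊥-elim)
open import Data.Unit using (⊤; tt)
open import Relation.Nullary using (¬_; Dec; yes; no)
open import Relation.Nullary.Decidable using (⌊_⌋; toWitness; fromWitness)
open import Relation.Unary using (Decidable)
open import Relation.Binary.PropositionalEquality
  using (_≡_; _≢_; refl; sym; trans; cong; cong₂; subst; module ≡-Reasoning)
open import Function using (_∘_; id)
open import Function.Bundles using (_⇔_; mk⇔; Equivalence)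
open import Function.Properties.Equivalence using () renaming (trans to ⇔-trans; sym to ⇔-sym)

open Equivalence using (to; from)

-- Counting the true values of a boolean function on Fin m; the degree of
-- a vertex of a graph given by 'tabulate' is such a count.

count : ∀ {m} → (Fin m → Bool) → ℕ
count {zero}  f = 0
count {suc m} f = (if f zero then 1 else 0) + count (f ∘ suc)

count-cong : ∀ {m} (f g : Fin m → Bool) → (∀ x → f x ≡ g x) → count f ≡ count g
count-cong {zero}  f g f≡g = refl
count-cong {suc m} f g f≡g rewrite f≡g zero =
  cong (_ +_) (count-cong (f ∘ suc) (g ∘ suc) (f≡g ∘ suc))

count-none : ∀ {m} (f : Fin m → Bool) → (∀ x → f x ≡ false) → count f ≡ 0
count-none {zero}  f none = refl
count-none {suc m} f none rewrite none zero = count-none (f ∘ suc) (none ∘ suc)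

count-single : ∀ {m} (f : Fin m → Bool) (c : Fin m) → (∀ x → IsTrue (f x) ⇔ (x ≡ c)) → count f ≡ 1
count-single {suc m} f zero f⇔ with f zero in f0
... | false = ⊥-elim (subst IsTrue f0 (from (f⇔ zero) refl))
... | true  = cong suc (count-none (f ∘ suc) false-after)
  where
  false-after : ∀ x → f (suc x) ≡ false
  false-after x with f (suc x) in fx
  ... | false = refl
  ... | true with to (f⇔ (suc x)) (subst IsTrue (sym fx) tt)
  ...   | ()
count-single {suc m} f (suc c) f⇔ with f zero in f0
... | true with to (f⇔ zero) (subst IsTrue (sym f0) tt)
...   | ()
count-single {suc m} f (suc c) f⇔ | false =
  count-single (f ∘ suc) c λ x →
    mk⇔ (Finₚ.suc-injective ∘ to (f⇔ (suc x))) (from (f⇔ (suc x)) ∘ cong suc)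

count-∨ : ∀ {m} (f g : Fin m → Bool) → (∀ x → IsTrue (f x) → IsTrue (g x) → ⊥)
          → count (λ x → f x ∨ g x) ≡ count f + count g
count-∨ {zero}  f g disjoint = refl
count-∨ {suc m} f g disjoint with f zero in f0 | g zero in g0
... | true  | true  = ⊥-elim (disjoint zero (subst IsTrue (sym f0) tt) (subst IsTrue (sym g0) tt))
... | true  | false = cong suc (count-∨ (f ∘ suc) (g ∘ suc) (disjoint ∘ suc))
... | false | true  = trans (cong suc (count-∨ (f ∘ suc) (g ∘ suc) (disjoint ∘ suc)))
                            (sym (ℕₚ.+-suc (count (f ∘ suc)) (count (g ∘ suc))))
... | false | false = count-∨ (f ∘ suc) (g ∘ suc) (disjoint ∘ suc)

count-split : ∀ a b (f : Fin (a + b) → Bool)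
              → count f ≡ count (λ x → f (x ↑ˡ b)) + count (λ y → f (a ↑ʳ y))
count-split zero    b f = refl
count-split (suc a) b f =
  trans (cong ((if f zero then 1 else 0) +_) (count-split a b (f ∘ suc))) (sym (ℕₚ.+-assoc (if f zero then 1 else 0) _ _))

∣tabulate∣≡count : ∀ {m} (f : Fin m → Bool) → ∣ tabulate f ∣ ≡ count f
∣tabulate∣≡count {zero}  f = refl
∣tabulate∣≡count {suc m} f with f zero
... | true  = cong suc (∣tabulate∣≡count (f ∘ suc))
... | false = ∣tabulate∣≡count (f ∘ suc)

∈-tabulate⁺ : ∀ {m} (f : Fin m → Bool) x → IsTrue (f x) → x ∈ tabulate f
∈-tabulate⁺ f zero    fx with f zero
... | true = here
∈-tabulate⁺ f (suc x) fx = there (∈-tabulate⁺ (f ∘ suc) x fx)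

∈-tabulate⁻ : ∀ {m} (f : Fin m → Bool) x → x ∈ tabulate f → IsTrue (f x)
∈-tabulate⁻ f zero    x∈ with f zero
∈-tabulate⁻ f zero    here | true = tt
∈-tabulate⁻ f (suc x) (there x∈) = ∈-tabulate⁻ (f ∘ suc) x x∈

_==_ : ∀ {m} → Fin m → Fin m → Bool
x == y = ⌊ x ≟ y ⌋

==-cong-injective : ∀ {m m'} (f : Fin m → Fin m') → (∀ {a b} → f a ≡ f b → a ≡ b)
                    → ∀ a b → (f a == f b) ≡ (a == b)
==-cong-injective f f-inj a b with a ≟ b | f a ≟ f b
... | yes _   | yes _   = refl
... | yes a≡b | no fa≢  = ⊥-elim (fa≢ (cong f a≡b))
... | no a≢b  | yes fa≡ = ⊥-elim (a≢b (f-inj fa≡))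
... | no _    | no _    = refl

==-false : ∀ {m} (a b : Fin m) → a ≢ b → (a == b) ≡ false
==-false a b a≢b with a ≟ b
... | yes a≡b = ⊥-elim (a≢b a≡b)
... | no _    = refl

module _ {m : ℕ} {R : Fin m → Fin m → Set} where

  Reach-snoc : ∀ {u v w} → Reach R u v → R v w → Reach R u w
  Reach-snoc here         r = there r here
  Reach-snoc (there s ws) r = there s (Reach-snoc ws r)

  Reach-++ : ∀ {u v w} → Reach R u v → Reach R v w → Reach R u w
  Reach-++ here         vs = vs
  Reach-++ (there s us) vs = there s (Reach-++ us vs)

  Reach-reverse : (∀ {x y} → R x y → R y x) → ∀ {u v} → Reach R u v → Reach R v u
  Reach-reverse R-sym here         = here
  Reach-reverse R-sym (there s ws) = Reach-snoc (Reach-reverse R-sym ws) (R-sym s)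

Reach-preserves : ∀ {m} {R : Fin m → Fin m → Set} {P : Fin m → Set}
                  → (∀ {x y} → P x → R x y → P y) → ∀ {u v} → P u → Reach R u v → P v
Reach-preserves keep Pu here         = Pu
Reach-preserves keep Pu (there s ws) = Reach-preserves keep (keep Pu s) ws

Reach-map : ∀ {m} {R Q : Fin m → Fin m → Set} → (∀ {x y} → R x y → Q x y)
            → ∀ {u v} → Reach R u v → Reach Q u v
Reach-map f here         = here
Reach-map f (there s ws) = there (f s) (Reach-map f ws)

lastOf : ∀ {A : Set} → A → List A → A
lastOf x []       = x
lastOf x (y ∷ ys) = lastOf y ys

lastOf-snoc : ∀ {A : Set} (y : A) ys a → lastOf y (ys ++ [ a ]) ≡ a
lastOf-snoc y []       a = refl
lastOf-snoc y (z ∷ zs) a = lastOf-snoc z zs a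

lastOf-avoids : ∀ {A : Set} (w y : A) ys → All (w ≢_) (y ∷ ys) → w ≢ lastOf y ys
lastOf-avoids w y []       (w≢y ∷ _) = w≢y
lastOf-avoids w y (z ∷ zs) (_ ∷ w∉) = lastOf-avoids w z zs w∉

Linked-snoc : ∀ {A : Set} {R : A → A → Set} {x xs y}
              → Linked R (x ∷ xs) → R (lastOf x xs) y → Linked R (x ∷ xs ++ [ y ])
Linked-snoc {xs = []}     [-]            r = r ∷ [-]
Linked-snoc {xs = z ∷ zs} (r ∷ linked) r' = r ∷ Linked-snoc linked r'

unique-length≤ : ∀ {m} (xs : List (Fin m)) → Unique xs → length xs ≤ m
unique-length≤ xs distinct = Finₚ.injective⇒≤ (lookup-injective xs distinct)
  where
  All-lookup : ∀ {m} {P : Fin m → Set} {xs} → All P xs → ∀ i → P (lookup xs i)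
  All-lookup (px ∷ _)  zero    = px
  All-lookup (_ ∷ all) (suc i) = All-lookup all i
  lookup-injective : ∀ {m} (xs : List (Fin m)) → Unique xs → ∀ {i j} → lookup xs i ≡ lookup xs j → i ≡ j
  lookup-injective (x ∷ xs) (x∉ ∷ _)        {zero}  {zero}  _  = refl
  lookup-injective (x ∷ xs) (x∉ ∷ _)        {zero}  {suc j} eq = ⊥-elim (All-lookup x∉ j eq)
  lookup-injective (x ∷ xs) (x∉ ∷ _)        {suc i} {zero}  eq = ⊥-elim (All-lookup x∉ i (sym eq))
  lookup-injective (x ∷ xs) (_ ∷ distinct) {suc i} {suc j} eq = cong suc (lookup-injective xs distinct eq)

subset-ext : ∀ {n} {X Z : Subset n} → (∀ a → a ∈ X ⇔ a ∈ Z) → X ≡ Z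
subset-ext X⇔Z = Subₚ.⊆-antisym (λ {a} → to (X⇔Z a)) (λ {a} → from (X⇔Z a))

∈-∪⇔ : ∀ {n} (X Z : Subset n) {a} → a ∈ X ∪ Z ⇔ (a ∈ X ⊎ a ∈ Z)
∈-∪⇔ X Z = mk⇔ (Subₚ.x∈p∪q⁻ X Z) Subₚ.x∈p∪q⁺

characterisation-unique : ∀ {n} {Q : Fin n → Set} {Z : Subset n} → (∀ a → Q a ⇔ a ∈ Z)
                          → ∀ X → (∀ a → a ∈ X ⇔ Q a) ⇔ (X ≡ Z)
characterisation-unique Q⇔Z X =
  mk⇔ (λ X⇔Q → subset-ext λ a → ⇔-trans (X⇔Q a) (Q⇔Z a))
      (λ { refl a → ⇔-sym (Q⇔Z a) })

∈𝒫-resp-≈F : ∀ {n} {𝒫 : Family n → Set} {F G : Family n} → F ≈F G → F ∈𝒫 𝒫 → G ∈𝒫 𝒫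
∈𝒫-resp-≈F F≈G (P , 𝒫P , P≈F) = P , 𝒫P , λ Z → ⇔-trans (P≈F Z) (F≈G Z)

same-block : ∀ {n} {P : Family n} → IsPartition P → ∀ {X Z a} → P X → P Z → a ∈ X → a ∈ Z → X ≡ Z
same-block (disjoint , _) {X} {Z} {a} PX PZ a∈X a∈Z with Vecₚ.≡-dec Boolₚ._≟_ X Z
... | yes X≡Z = X≡Z
... | no X≢Z  = ⊥-elim (disjoint X Z PX PZ X≢Z a a∈X a∈Z)

Disjoint : ∀ {n} → Subset n → Subset n → Set
Disjoint X Z = ∀ a → a ∈ X → a ∈ Z → ⊥

UnionOfBlocks : ∀ {n} → Family n → Subset n → Set
UnionOfBlocks {n} P S = ∀ a → a ∈ S → Σ[ Z ∈ Subset n ] (P Z × a ∈ Z × Z ⊆ S)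

block-inside-or-disjoint : ∀ {n} {P : Family n} {X S} → IsPartition P → P X → UnionOfBlocks P S
                           → X ⊆ S ⊎ Disjoint X S
block-inside-or-disjoint {X = X} {S} partition PX blocks with X Subₚ.⊆? S
... | yes X⊆S = inj₁ X⊆S
... | no X⊈S  = inj₂ λ a a∈X a∈S →
  let (Z , PZ , a∈Z , Z⊆S) = blocks a a∈S
  in X⊈S (λ {b} b∈X → Z⊆S (subst (b ∈_) (same-block partition PX PZ a∈X a∈Z) b∈X))

complement-pair-partition : ∀ {n} (S : Subset n) → IsPartition (pairF S (∁ S))
complement-pair-partition S = disjoint , covers
  where
  disjoint : ∀ X Y → pairF S (∁ S) X → pairF S (∁ S) Y → X ≢ Y → Disjoint X Y
  disjoint X Y (inj₁ refl) (inj₁ refl) X≢Y a _   _   = X≢Y refl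
  disjoint X Y (inj₂ refl) (inj₂ refl) X≢Y a _   _   = X≢Y refl
  disjoint X Y (inj₁ refl) (inj₂ refl) X≢Y a a∈X a∈Y = Subₚ.x∈p⇒x∉∁p a∈X a∈Y
  disjoint X Y (inj₂ refl) (inj₁ refl) X≢Y a a∈X a∈Y = Subₚ.x∈p⇒x∉∁p a∈Y a∈X
  covers : ∀ a → InUnion (pairF S (∁ S)) a
  covers a with a Subₚ.∈? S
  ... | yes a∈S = S , inj₁ refl , a∈S
  ... | no a∉S  = ∁ S , inj₂ refl , Subₚ.x∉p⇒x∈∁p a∉S

P-edge-swap : ∀ {m n} (G : Graph m) (β : Fin m → Subset n) u v → P-edge G β u v ≈F P-edge G β v u
P-edge-swap G β u v X = mk⇔ swap swap
  where
  flip-step : ∀ {u v x y} → StepAvoidEdge G u v x y → StepAvoidEdge G v u x y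
  flip-step (adj , not-e) = adj , λ { (inj₁ e) → not-e (inj₂ e) ; (inj₂ e) → not-e (inj₁ e) }
  flip-union : ∀ {u v w} → IsLeafUnion G (StepAvoidEdge G u v) β w X
               → IsLeafUnion G (StepAvoidEdge G v u) β w X
  flip-union X≡ a = mk⇔ (λ a∈X → let (ℓ , is-leaf , walk , a∈) = to (X≡ a) a∈X
                                   in ℓ , is-leaf , Reach-map flip-step walk , a∈)
                         (λ (ℓ , is-leaf , walk , a∈) → from (X≡ a) (ℓ , is-leaf , Reach-map flip-step walk , a∈))
  swap : ∀ {u v} → P-edge G β u v X → P-edge G β v u X
  swap (inj₁ U) = inj₂ (flip-union U)
  swap (inj₂ V) = inj₁ (flip-union V)

one-element : ∀ {n} {s : Subset n} {v} → v ∈ s → 1 ≤ ∣ s ∣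
one-element {s = inside ∷ s}  here      = s≤s z≤n
one-element {s = outside ∷ s} (there i) = one-element i
one-element {s = inside ∷ s}  (there i) = s≤s z≤n

two-elements : ∀ {n} {s : Subset n} {v w} → v ∈ s → w ∈ s → v ≢ w → 2 ≤ ∣ s ∣
two-elements here here v≢w = ⊥-elim (v≢w refl)
two-elements {s = inside ∷ s}  here      (there j) _   = s≤s (one-element j)
two-elements {s = inside ∷ s}  (there i) here      _   = s≤s (one-element i)
two-elements {s = outside ∷ s} (there i) (there j) v≢w = two-elements i j (v≢w ∘ cong suc)
two-elements {s = inside ∷ s}  (there i) (there j) v≢w =
  ℕₚ.≤-trans (two-elements i j (v≢w ∘ cong suc)) (ℕₚ.n≤1+n _)

at-most-one : ∀ {n} {s : Subset n} {v w} → ∣ s ∣ ≤ 1 → v ∈ s → w ∈ s → w ≡ v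
at-most-one {v = v} {w} ∣s∣≤1 v∈s w∈s with w ≟ v
... | yes w≡v = w≡v
... | no w≢v  = ⊥-elim (ℕₚ.<-irrefl refl (ℕₚ.≤-trans (two-elements w∈s v∈s w≢v) ∣s∣≤1))

another-element : ∀ {n} (s : Subset n) → ¬ (∣ s ∣ ≤ 1) → ∀ v → Σ[ w ∈ Fin n ] (w ∈ s × w ≢ v)
another-element s big v with any? other?
  where
  other? : ∀ w → Dec (w ∈ s × w ≢ v)
  other? w with w Subₚ.∈? s | w ≟ v
  ... | yes w∈s | no w≢v  = yes (w∈s , w≢v)
  ... | yes _   | yes w≡v = no λ { (_ , w≢v) → w≢v w≡v }
  ... | no w∉s  | _       = no λ { (w∈s , _) → w∉s w∈s }
... | yes found = found
... | no none   = ⊥-elim (big (subst (∣ s ∣ ≤_) (Subₚ.∣⁅x⁆∣≡1 v) (Subₚ.p⊆q⇒∣p∣≤∣q∣ s⊆⁅v⁆)))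
  where
  s⊆⁅v⁆ : s ⊆ ⁅ v ⁆
  s⊆⁅v⁆ {w} w∈s with w ≟ v
  ... | yes refl = Subₚ.x∈⁅x⁆ v
  ... | no w≢v   = ⊥-elim (none (w , w∈s , w≢v))

leaf⇔ : ∀ {m} (G : Graph m) u {c} → degree G u ≡ suc c → IsLeaf G u ⇔ (c ≡ 0)
leaf⇔ G u deg≡ = mk⇔ (λ is-leaf → at-most-zero (subst (_≤ 1) deg≡ is-leaf))
                      (λ { refl → subst (_≤ 1) (sym deg≡) ℕₚ.≤-refl })
  where
  at-most-zero : ∀ {c} → suc c ≤ 1 → c ≡ 0
  at-most-zero (s≤s z≤n) = refl

-- Rooted trees on Fin (suc k) with root zero, given by parent pointers
-- which strictly decrease the index (so following them reaches the root).

record PointerTree (k : ℕ) : Set where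
  field
    parent  : Fin (suc k) → Fin (suc k)
    parent< : ∀ u → u ≢ zero → toℕ (parent u) < toℕ u

isNonRoot : ∀ {k} → Fin (suc k) → Bool
isNonRoot zero    = false
isNonRoot (suc _) = true

isNonRoot⇔ : ∀ {k} (u : Fin (suc k)) → IsTrue (isNonRoot u) ⇔ (u ≢ zero)
isNonRoot⇔ zero    = mk⇔ (λ ()) (λ u≢0 → u≢0 refl)
isNonRoot⇔ (suc u) = mk⇔ (λ _ ()) (λ _ → tt)

module PointerTreeGraph {k : ℕ} (𝕋 : PointerTree k) where

  open PointerTree 𝕋

  Vertex : Set
  Vertex = Fin (suc k)

  ChildOf : Vertex → Vertex → Set
  ChildOf u v = u ≢ zero × parent u ≡ v

  Edge : Vertex → Vertex → Set
  Edge u v = ChildOf u v ⊎ ChildOf v u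

  isChild : Vertex → Vertex → Bool
  isChild v u = isNonRoot u ∧ (parent u == v)

  isChild⇔ : ∀ v u → IsTrue (isChild v u) ⇔ ChildOf u v
  isChild⇔ v u = ⇔-trans T-∧ (mk⇔ (λ (nr , p≡) → to (isNonRoot⇔ u) nr , toWitness p≡)
                                  (λ (u≢0 , p≡) → from (isNonRoot⇔ u) u≢0 , fromWitness p≡))

  adjacent? : Vertex → Vertex → Bool
  adjacent? u v = isChild v u ∨ isChild u v

  graph : Graph (suc k)
  graph u = tabulate (adjacent? u)

  Adj⇔Edge : ∀ u v → Adj graph u v ⇔ Edge u v
  Adj⇔Edge u v =
    ⇔-trans (mk⇔ (∈-tabulate⁻ (adjacent? u) v) (∈-tabulate⁺ (adjacent? u) v))
            (⇔-trans T-∨ (isChild⇔ v u ⊎-⇔ isChild⇔ u v))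

  children : Vertex → ℕ
  children u = count (isChild u)

  data Descendant (u : Vertex) : Vertex → Set where
    self : Descendant u u
    step : ∀ {x} → x ≢ zero → Descendant u (parent x) → Descendant u x

  LabelsBelow : ∀ {n} → (Vertex → Subset n) → Vertex → Fin n → Set
  LabelsBelow β u a = Σ[ ℓ ∈ Vertex ] (children ℓ ≡ 0 × Descendant u ℓ × a ∈ β ℓ)

  parent-induction : (P : Vertex → Set) → P zero → (∀ u → u ≢ zero → P (parent u) → P u) → ∀ u → P u
  parent-induction P base inherit u = go (suc (toℕ u)) u ℕₚ.≤-refl
    where
    go : ∀ fuel u → toℕ u < fuel → P u
    go fuel       zero    _        = base
    go (suc fuel) (suc u) (s≤s lt) =
      inherit (suc u) (λ ()) (go fuel (parent (suc u)) (ℕₚ.≤-trans (parent< (suc u) (λ ())) lt))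

  parent≢ : ∀ u → u ≢ zero → parent u ≢ u
  parent≢ u u≢0 p≡u = ℕₚ.<-irrefl (cong toℕ p≡u) (parent< u u≢0)

  ChildOf< : ∀ {u v} → ChildOf u v → toℕ v < toℕ u
  ChildOf< {u} (u≢0 , refl) = parent< u u≢0

  not-both-children : ∀ {u v} → ChildOf u v → ChildOf v u → ⊥
  not-both-children u→v v→u = ℕₚ.<-asym (ChildOf< u→v) (ChildOf< v→u)

  symmetric : Symmetric graph
  symmetric u v uv with to (Adj⇔Edge u v) uv
  ... | inj₁ e = from (Adj⇔Edge v u) (inj₂ e)
  ... | inj₂ e = from (Adj⇔Edge v u) (inj₁ e)

  irreflexive : Irreflexive graph
  irreflexive u uu with to (Adj⇔Edge u u) uu
  ... | inj₁ (u≢0 , p≡u) = parent≢ u u≢0 p≡u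
  ... | inj₂ (u≢0 , p≡u) = parent≢ u u≢0 p≡u

  to-root : ∀ u → Reach (Adj graph) u zero
  to-root = parent-induction _ here
              λ u u≢0 → there (from (Adj⇔Edge u (parent u)) (inj₁ (u≢0 , refl)))

  connected : Connected graph
  connected u v = Reach-++ (to-root u) (Reach-reverse (symmetric _ _) (to-root v))

  -- Along a walk that never returns at once to the vertex it
  -- came from, a step down to a child is only followed by steps down.  So a
  -- cycle either goes monotonically in index (impossible, as it is closed)
  -- or ends with a step down into its first vertex while starting with a
  -- step up from it, which makes its second and last vertices equal.

  NoBacktrack : List Vertex → Set
  NoBacktrack (x ∷ y ∷ z ∷ rest) = x ≢ z × NoBacktrack (y ∷ z ∷ rest)
  NoBacktrack _                  = ⊤

  EndsDownward : List Vertex → Set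
  EndsDownward (x ∷ y ∷ [])       = ChildOf y x
  EndsDownward (x ∷ y ∷ z ∷ rest) = EndsDownward (y ∷ z ∷ rest)
  EndsDownward _                  = ⊤

  descent-persists : ∀ x y rest → Linked (Adj graph) (x ∷ y ∷ rest) → NoBacktrack (x ∷ y ∷ rest)
                     → ChildOf y x → toℕ x < toℕ (lastOf y rest) × EndsDownward (x ∷ y ∷ rest)
  descent-persists x y []         _           _          y→x = ChildOf< y→x , y→x
  descent-persists x y (z ∷ rest) (_ ∷ walk) (x≢z , nb) y→x with to (Adj⇔Edge y z) (Linked.head walk)
  ... | inj₁ (_ , py≡z) = ⊥-elim (x≢z (trans (sym (proj₂ y→x)) py≡z))
  ... | inj₂ z→y        = let (y<last , ends) = descent-persists y z rest walk nb z→y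
                          in ℕₚ.<-trans (ChildOf< y→x) y<last , ends

  ascent-or-final-descent : ∀ x y rest → Linked (Adj graph) (x ∷ y ∷ rest) → NoBacktrack (x ∷ y ∷ rest)
                            → ChildOf x y → toℕ (lastOf y rest) < toℕ x ⊎ EndsDownward (x ∷ y ∷ rest)
  ascent-or-final-descent x y []         _          _        x→y = inj₁ (ChildOf< x→y)
  ascent-or-final-descent x y (z ∷ rest) (_ ∷ walk) (_ , nb) x→y with to (Adj⇔Edge y z) (Linked.head walk)
  ... | inj₂ z→y = inj₂ (proj₂ (descent-persists y z rest walk nb z→y))
  ... | inj₁ y→z with ascent-or-final-descent y z rest walk nb y→z
  ...   | inj₁ last<y = inj₁ (ℕₚ.<-trans last<y (ChildOf< x→y))
  ...   | inj₂ ends   = inj₂ ends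

  unique-no-backtrack : ∀ a xs → Unique xs → All (_≢ a) xs → NoBacktrack (xs ++ [ a ])
  unique-no-backtrack a []                _                        _             = tt
  unique-no-backtrack a (x ∷ [])          _                        _             = tt
  unique-no-backtrack a (x ∷ y ∷ [])      _                        (x≢a ∷ _)     = x≢a , tt
  unique-no-backtrack a (x ∷ y ∷ z ∷ xs) ((_ ∷ x≢z ∷ _) ∷ unique) (_ ∷ all≢a) =
    x≢z , unique-no-backtrack a (y ∷ z ∷ xs) unique all≢a

  EndsDownward-snoc : ∀ x y ys a → EndsDownward (x ∷ y ∷ ys ++ [ a ]) → ChildOf a (lastOf y ys)
  EndsDownward-snoc x y []       a ends = ends
  EndsDownward-snoc x y (z ∷ zs) a ends = EndsDownward-snoc y z zs a ends

  acyclic : ¬ HasCycle graph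
  acyclic (v , []          , () , _)
  acyclic (v , w₁ ∷ []     , s≤s () , _)
  acyclic (v , w₁ ∷ w₂ ∷ ws , _ , (v∉@(_ ∷ v≢w₂ ∷ _) ∷ ws-unique@(w₁∉ ∷ _)) , walk) =
    first-step (to (Adj⇔Edge v w₁) (Linked.head walk))
    where
    returns : lastOf w₁ (w₂ ∷ ws ++ [ v ]) ≡ v
    returns = lastOf-snoc w₁ (w₂ ∷ ws) v
    no-backtrack : NoBacktrack (v ∷ w₁ ∷ w₂ ∷ ws ++ [ v ])
    no-backtrack = v≢w₂ , unique-no-backtrack v (w₁ ∷ w₂ ∷ ws) ws-unique (All.map (λ v≢ → v≢ ∘ sym) v∉)
    first-step : Edge v w₁ → ⊥
    first-step (inj₂ w₁→v) =
      ℕₚ.<-irrefl (sym (cong toℕ returns)) (proj₁ (descent-persists v w₁ _ walk no-backtrack w₁→v))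
    first-step (inj₁ v→w₁) with ascent-or-final-descent v w₁ _ walk no-backtrack v→w₁
    ... | inj₁ last<v = ℕₚ.<-irrefl (cong toℕ returns) last<v
    ... | inj₂ ends   = lastOf-avoids w₁ w₂ ws w₁∉
                          (trans (sym (proj₂ v→w₁)) (proj₂ (EndsDownward-snoc v w₁ (w₂ ∷ ws) v ends)))

  is-tree : IsTree graph
  is-tree = s≤s z≤n , symmetric , irreflexive , connected , acyclic

  degree≡ : ∀ u → degree graph u ≡ (if isNonRoot u then 1 else 0) + children u
  degree≡ u = trans (∣tabulate∣≡count (adjacent? u))
                (trans (count-∨ (λ v → isChild v u) (isChild u) one-direction)
                       (cong (_+ children u) (parents u)))
    where
    one-direction : ∀ v → IsTrue (isChild v u) → IsTrue (isChild u v) → ⊥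
    one-direction v u→v v→u = not-both-children (to (isChild⇔ v u) u→v) (to (isChild⇔ u v) v→u)
    parents : ∀ u → count (λ v → isChild v u) ≡ (if isNonRoot u then 1 else 0)
    parents zero    = count-none (λ v → isChild v zero) (λ _ → refl)
    parents (suc u) = count-single (λ v → isChild v (suc u)) (parent (suc u)) λ v →
      ⇔-trans (isChild⇔ v (suc u)) (mk⇔ (sym ∘ proj₂) (λ v≡p → (λ ()) , sym v≡p))

  Descendant≤ : ∀ {u x} → Descendant u x → toℕ u ≤ toℕ x
  Descendant≤ self                 = ℕₚ.≤-refl
  Descendant≤ {x = x} (step x≢0 d) = ℕₚ.<⇒≤ (ℕₚ.≤-<-trans (Descendant≤ d) (parent< x x≢0))

  Descendant-parent : ∀ {u x} → Descendant u x → u ≢ x → Descendant u (parent x)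
  Descendant-parent self       u≢x = ⊥-elim (u≢x refl)
  Descendant-parent (step _ d) _   = d

  Descendant≢root : ∀ {u x} → Descendant u x → u ≢ zero → x ≢ zero
  Descendant≢root d u≢0 refl = u≢0 (toℕ-injective (ℕₚ.n≤0⇒n≡0 (Descendant≤ d)))

  leaf⇔childless : ∀ ℓ → ℓ ≢ zero → IsLeaf graph ℓ ⇔ (children ℓ ≡ 0)
  leaf⇔childless zero    ℓ≢0 = ⊥-elim (ℓ≢0 refl)
  leaf⇔childless (suc ℓ) _   = leaf⇔ graph (suc ℓ) (degree≡ (suc ℓ))

  LabelsBelow⇔leaves : ∀ {n} (β : Vertex → Subset n) u a → u ≢ zero
                       → LabelsBelow β u a ⇔ (Σ[ ℓ ∈ Vertex ] (IsLeaf graph ℓ × Descendant u ℓ × a ∈ β ℓ))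
  LabelsBelow⇔leaves β u a u≢0 =
    mk⇔ (λ (ℓ , childless , d , a∈) → ℓ , from (leaf⇔childless ℓ (Descendant≢root d u≢0)) childless , d , a∈)
        (λ (ℓ , is-leaf , d , a∈) → ℓ , to (leaf⇔childless ℓ (Descendant≢root d u≢0)) is-leaf , d , a∈)

  not-above-parent : ∀ u → u ≢ zero → ¬ Descendant u (parent u)
  not-above-parent u u≢0 d = ℕₚ.<-irrefl refl (ℕₚ.≤-<-trans (Descendant≤ d) (parent< u u≢0))

  root-ancestor : ∀ x → Descendant zero x
  root-ancestor = parent-induction (Descendant zero) self (λ _ → step)

  Descendant? : ∀ u x → Dec (Descendant u x)
  Descendant? u = parent-induction (λ x → Dec (Descendant u x)) at-root inherit
    where
    at-root : Dec (Descendant u zero)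
    at-root with u ≟ zero
    ... | yes refl = yes self
    ... | no u≢0   = no λ d → Descendant≢root d u≢0 refl
    inherit : ∀ x → x ≢ zero → Dec (Descendant u (parent x)) → Dec (Descendant u x)
    inherit x x≢0 dec-parent with u ≟ x | dec-parent
    ... | yes refl | _      = yes self
    ... | no u≢x   | yes d  = yes (step x≢0 d)
    ... | no u≢x   | no ¬d  = no λ d → ¬d (Descendant-parent d u≢x)

  -- Removing the edge between c and its parent splits the tree into the
  -- subtree of c and the rest; so the cut of that edge is {Y, Yᶜ} where Y
  -- collects the labels of the leaves below c.
  module EdgeCut (c : Vertex) (c≢0 : c ≢ zero) where

    Step : Vertex → Vertex → Set
    Step = StepAvoidEdge graph c (parent c)

    Step-sym : ∀ {x y} → Step x y → Step y x
    Step-sym {x} {y} (adj , not-e) = symmetric x y adj , λ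
      { (inj₁ (y≡c , x≡p)) → not-e (inj₂ (x≡p , y≡c))
      ; (inj₂ (y≡p , x≡c)) → not-e (inj₁ (x≡c , y≡p)) }

    below-step : ∀ {y z} → Descendant c y → Step y z → Descendant c z
    below-step {y} {z} d (adj , not-e) with to (Adj⇔Edge y z) adj
    ... | inj₂ (z≢0 , refl) = step z≢0 d
    ... | inj₁ (_ , refl) with c ≟ y
    ...   | yes refl = ⊥-elim (not-e (inj₁ (refl , refl)))
    ...   | no c≢y   = Descendant-parent d c≢y

    outside-step : ∀ {y z} → ¬ Descendant c y → Step y z → ¬ Descendant c z
    outside-step {y} {z} ¬d (adj , not-e) with to (Adj⇔Edge y z) adj
    ... | inj₁ (y≢0 , refl) = λ d → ¬d (step y≢0 d)
    ... | inj₂ (z≢0 , refl) = λ d → back-inside d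
      where
      back-inside : Descendant c z → ⊥
      back-inside d with c ≟ z
      ... | yes refl = not-e (inj₂ (refl , refl))
      ... | no c≢z   = ¬d (Descendant-parent d c≢z)

    reaches-below : ∀ {x} → Descendant c x → Reach Step c x
    reaches-below self = here
    reaches-below {x} (step x≢0 d) =
      Reach-snoc (reaches-below d) (from (Adj⇔Edge (parent x) x) (inj₂ (x≢0 , refl)) , not-e)
      where
      not-e : ¬ ((parent x ≡ c × x ≡ parent c) ⊎ (parent x ≡ parent c × x ≡ c))
      not-e (inj₁ (px≡c , x≡pc)) = not-both-children (x≢0 , px≡c) (c≢0 , sym x≡pc)
      not-e (inj₂ (_ , refl))    = not-above-parent c c≢0 d

    outside-to-root : ∀ y → ¬ Descendant c y → Reach Step y zero
    outside-to-root = parent-induction _ (λ _ → here) λ y y≢0 up ¬d →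
      there (from (Adj⇔Edge y (parent y)) (inj₁ (y≢0 , refl)) , not-e y≢0 ¬d) (up (λ d → ¬d (step y≢0 d)))
      where
      not-e : ∀ {y} → y ≢ zero → ¬ Descendant c y
              → ¬ ((y ≡ c × parent y ≡ parent c) ⊎ (y ≡ parent c × parent y ≡ c))
      not-e _   ¬d (inj₁ (refl , _))    = ¬d self
      not-e y≢0 _  (inj₂ (y≡pc , py≡c)) = not-both-children (y≢0 , py≡c) (c≢0 , sym y≡pc)

    reaches-outside : ∀ {x} → ¬ Descendant c x → Reach Step (parent c) x
    reaches-outside {x} ¬d = Reach-++ (outside-to-root (parent c) (not-above-parent c c≢0))
                                      (Reach-reverse Step-sym (outside-to-root x ¬d))

    module _ {n} (β : Vertex → Subset n) (Y : Subset n)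
             (Y-spec : ∀ a → a ∈ Y ⇔ (Σ[ ℓ ∈ Vertex ] (IsLeaf graph ℓ × Descendant c ℓ × a ∈ β ℓ)))
             (leaves-disjoint : ∀ ℓ ℓ' → IsLeaf graph ℓ → IsLeaf graph ℓ' → ℓ ≢ ℓ' → Disjoint (β ℓ) (β ℓ'))
             (leaves-cover : ∀ a → Σ[ ℓ ∈ Vertex ] (IsLeaf graph ℓ × a ∈ β ℓ)) where

      below-side : ∀ a → leafUnion graph Step β c a ⇔ a ∈ Y
      below-side a =
        mk⇔ (λ (ℓ , is-leaf , walk , a∈) → from (Y-spec a) (ℓ , is-leaf , Reach-preserves below-step self walk , a∈))
            (λ a∈Y → let (ℓ , is-leaf , d , a∈) = to (Y-spec a) a∈Y in ℓ , is-leaf , reaches-below d , a∈)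

      above-side : ∀ a → leafUnion graph Step β (parent c) a ⇔ a ∈ ∁ Y
      above-side a = mk⇔ to-∁ from-∁
        where
        to-∁ : leafUnion graph Step β (parent c) a → a ∈ ∁ Y
        to-∁ (ℓ , is-leaf , walk , a∈) = Subₚ.x∉p⇒x∈∁p λ a∈Y →
          let (ℓ' , is-leaf' , d' , a∈') = to (Y-spec a) a∈Y
              ¬d = Reach-preserves outside-step (not-above-parent c c≢0) walk
          in leaves-disjoint ℓ ℓ' is-leaf is-leaf' (λ { refl → ¬d d' }) a a∈ a∈'
        from-∁ : a ∈ ∁ Y → leafUnion graph Step β (parent c) a
        from-∁ a∈∁Y with leaves-cover a
        ... | (ℓ , is-leaf , a∈) with Descendant? c ℓ
        ...   | yes d = ⊥-elim (Subₚ.x∈∁p⇒x∉p a∈∁Y (from (Y-spec a) (ℓ , is-leaf , d , a∈)))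
        ...   | no ¬d = ℓ , is-leaf , reaches-outside ¬d , a∈

      edge-cut : P-edge graph β c (parent c) ≈F pairF Y (∁ Y)
      edge-cut X = characterisation-unique below-side X ⊎-⇔ characterisation-unique above-side X

-- Gluing two pointer trees: the vertices of A come first and those of B
-- after them, and the root of B becomes a child of the root of A.
module Glue {kA kB : ℕ} (𝔸 : PointerTree kA) (𝔹 : PointerTree kB) where

  module A = PointerTreeGraph 𝔸
  module B = PointerTreeGraph 𝔹
  open PointerTree 𝔸 using () renaming (parent to parentA; parent< to parentA<)
  open PointerTree 𝔹 using () renaming (parent to parentB; parent< to parentB<)

  k : ℕ
  k = kA + suc kB

  inA : Fin (suc kA) → Fin (suc k)
  inA x = x ↑ˡ suc kB

  inB : Fin (suc kB) → Fin (suc k)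
  inB y = suc kA ↑ʳ y

  glue : {X : Set} → (Fin (suc kA) → X) → (Fin (suc kB) → X) → Fin (suc k) → X
  glue f g v = [ f , g ]′ (splitAt (suc kA) v)

  glue-inA : ∀ {X : Set} (f : Fin (suc kA) → X) g x → glue f g (inA x) ≡ f x
  glue-inA f g x rewrite Finₚ.splitAt-↑ˡ (suc kA) x (suc kB) = refl

  glue-inB : ∀ {X : Set} f (g : Fin (suc kB) → X) y → glue f g (inB y) ≡ g y
  glue-inB f g y rewrite Finₚ.splitAt-↑ʳ (suc kA) (suc kB) y = refl

  view : ∀ v → (Σ[ x ∈ Fin (suc kA) ] v ≡ inA x) ⊎ (Σ[ y ∈ Fin (suc kB) ] v ≡ inB y)
  view v with splitAt (suc kA) v in split≡
  ... | inj₁ x = inj₁ (x , sym (Finₚ.splitAt⁻¹-↑ˡ split≡))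
  ... | inj₂ y = inj₂ (y , sym (Finₚ.splitAt⁻¹-↑ʳ split≡))

  inA-injective : ∀ {x x'} → inA x ≡ inA x' → x ≡ x'
  inA-injective = Finₚ.↑ˡ-injective (suc kB) _ _

  inB-injective : ∀ {y y'} → inB y ≡ inB y' → y ≡ y'
  inB-injective = Finₚ.↑ʳ-injective (suc kA) _ _

  inA≢inB : ∀ x y → inA x ≢ inB y
  inA≢inB x y eq = ℕₚ.<-irrefl
    (trans (sym (Finₚ.toℕ-↑ˡ x (suc kB))) (trans (cong toℕ eq) (Finₚ.toℕ-↑ʳ (suc kA) y)))
    (ℕₚ.≤-trans (toℕ<n x) (ℕₚ.m≤m+n (suc kA) (toℕ y)))

  inA≢root : ∀ {x} → x ≢ zero → inA x ≢ zero
  inA≢root x≢0 eq = x≢0 (inA-injective eq)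

  parentB′ : Fin (suc kB) → Fin (suc k)
  parentB′ zero    = inA zero
  parentB′ (suc y) = inB (parentB (suc y))

  parent : Fin (suc k) → Fin (suc k)
  parent = glue (inA ∘ parentA) parentB′

  parent-inA : ∀ x → parent (inA x) ≡ inA (parentA x)
  parent-inA = glue-inA (inA ∘ parentA) parentB′

  parent-inB : ∀ y → parent (inB y) ≡ parentB′ y
  parent-inB = glue-inB (inA ∘ parentA) parentB′

  parent< : ∀ u → u ≢ zero → toℕ (parent u) < toℕ u
  parent< u u≢0 with view u
  ... | inj₁ (x , refl) rewrite parent-inA x | Finₚ.toℕ-↑ˡ (parentA x) (suc kB) | Finₚ.toℕ-↑ˡ x (suc kB) =
        parentA< x (u≢0 ∘ cong inA)
  ... | inj₂ (zero , refl) rewrite parent-inB zero | Finₚ.toℕ-↑ʳ (suc kA) (zero {kB}) = s≤s z≤n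
  ... | inj₂ (suc y , refl)
        rewrite parent-inB (suc y) | Finₚ.toℕ-↑ʳ (suc kA) (parentB (suc y)) | Finₚ.toℕ-↑ʳ (suc kA) (suc y) =
        ℕₚ.+-monoʳ-< (suc kA) (parentB< (suc y) (λ ()))

  glued : PointerTree k
  glued = record { parent = parent ; parent< = parent< }

  open PointerTreeGraph glued

  isNonRoot-inA : ∀ x → isNonRoot (inA x) ≡ isNonRoot x
  isNonRoot-inA zero    = refl
  isNonRoot-inA (suc x) = refl

  children-inA : ∀ x → children (inA x) ≡ A.children x + (if zero == x then 1 else 0)
  children-inA x = begin
    children (inA x)
      ≡⟨ count-split (suc kA) (suc kB) (isChild (inA x)) ⟩
    count (λ x' → isChild (inA x) (inA x')) + count (λ y → isChild (inA x) (inB y))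
      ≡⟨ cong₂ _+_ (count-cong (λ x' → isChild (inA x) (inA x')) (A.isChild x) from-A)
                   (count-cong (λ y → isChild (inA x) (inB y)) root-of-B from-B) ⟩
    A.children x + ((if zero == x then 1 else 0) + count {kB} (λ _ → false))
      ≡⟨ cong (λ c → A.children x + ((if zero == x then 1 else 0) + c))
              (count-none {kB} (λ _ → false) (λ _ → refl)) ⟩
    A.children x + ((if zero == x then 1 else 0) + 0)
      ≡⟨ cong (A.children x +_) (ℕₚ.+-identityʳ _) ⟩
    A.children x + (if zero == x then 1 else 0) ∎
    where
    open ≡-Reasoning
    from-A : ∀ x' → isChild (inA x) (inA x') ≡ A.isChild x x'
    from-A x' rewrite parent-inA x' | isNonRoot-inA x' =
      cong (isNonRoot x' ∧_) (==-cong-injective inA inA-injective (parentA x') x)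
    root-of-B : Fin (suc kB) → Bool
    root-of-B zero    = zero == x
    root-of-B (suc _) = false
    from-B : ∀ y → isChild (inA x) (inB y) ≡ root-of-B y
    from-B zero    rewrite parent-inB zero = ==-cong-injective inA inA-injective zero x
    from-B (suc y) rewrite parent-inB (suc y) = ==-false _ _ λ eq → inA≢inB x (parentB (suc y)) (sym eq)

  children-inA≢root : ∀ x → x ≢ zero → children (inA x) ≡ A.children x
  children-inA≢root x x≢0 =
    trans (children-inA x) (trans (cong (λ b → A.children x + (if b then 1 else 0)) (==-false zero x (x≢0 ∘ sym)))
                                  (ℕₚ.+-identityʳ _))

  children-root : children (inA zero) ≡ suc (A.children zero)
  children-root = trans (children-inA zero) (ℕₚ.+-comm (A.children zero) 1)

  children-inB : ∀ y → children (inB y) ≡ B.children y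
  children-inB y =
    trans (count-split (suc kA) (suc kB) (isChild (inB y)))
          (trans (cong (_+ count (λ y' → isChild (inB y) (inB y'))) (count-none _ none-in-A))
                 (count-cong _ _ from-B))
    where
    none-in-A : ∀ x → isChild (inB y) (inA x) ≡ false
    none-in-A x rewrite parent-inA x with isNonRoot (inA x)
    ... | false = refl
    ... | true  = ==-false _ _ λ eq → inA≢inB (parentA x) y eq
    from-B : ∀ y' → isChild (inB y) (inB y') ≡ B.isChild y y'
    from-B zero     rewrite parent-inB zero     = ==-false _ _ λ eq → inA≢inB zero y eq
    from-B (suc y') rewrite parent-inB (suc y') = ==-cong-injective inB inB-injective (parentB (suc y')) y

  Descendant-inA⁺ : ∀ {x y} → A.Descendant x y → Descendant (inA x) (inA y)
  Descendant-inA⁺ A.self = self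
  Descendant-inA⁺ {x} (A.step {y} y≢0 d) =
    step (inA≢root y≢0) (subst (Descendant (inA x)) (sym (parent-inA y)) (Descendant-inA⁺ d))

  Descendant-inB⁺ : ∀ {x y} → B.Descendant x y → Descendant (inB x) (inB y)
  Descendant-inB⁺ B.self = self
  Descendant-inB⁺ (B.step {zero} y≢0 d) = ⊥-elim (y≢0 refl)
  Descendant-inB⁺ {x} (B.step {suc y} _ d) =
    step (λ ()) (subst (Descendant (inB x)) (sym (parent-inB (suc y))) (Descendant-inB⁺ d))

  Descendant-inA⁻ : ∀ {x z} → x ≢ zero → Descendant (inA x) z → Σ[ y ∈ Fin (suc kA) ] (z ≡ inA y × A.Descendant x y)
  Descendant-inA⁻ x≢0 self = _ , refl , A.self
  Descendant-inA⁻ {x} x≢0 (step {z} z≢0 d) with Descendant-inA⁻ x≢0 d | view z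
  ... | (y , eq , dy) | inj₁ (w , refl) =
        w , refl , A.step (z≢0 ∘ cong inA) (subst (A.Descendant x) (inA-injective (trans (sym eq) (parent-inA w))) dy)
  ... | (y , eq , dy) | inj₂ (zero , refl) =
        ⊥-elim (A.Descendant≢root dy x≢0 (sym (inA-injective (trans (sym (parent-inB zero)) eq))))
  ... | (y , eq , dy) | inj₂ (suc w , refl) = ⊥-elim (inA≢inB y _ (sym (trans (sym (parent-inB (suc w))) eq)))

  Descendant-inB⁻ : ∀ {x z} → Descendant (inB x) z → Σ[ y ∈ Fin (suc kB) ] (z ≡ inB y × B.Descendant x y)
  Descendant-inB⁻ self = _ , refl , B.self
  Descendant-inB⁻ {x} (step {z} z≢0 d) with Descendant-inB⁻ d | view z
  ... | (y , eq , dy) | inj₁ (w , refl) = ⊥-elim (inA≢inB (parentA w) y (trans (sym (parent-inA w)) eq))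
  ... | (y , eq , dy) | inj₂ (zero , refl) = ⊥-elim (inA≢inB zero y (trans (sym (parent-inB zero)) eq))
  ... | (y , eq , dy) | inj₂ (suc w , refl) =
        suc w , refl , B.step (λ ()) (subst (B.Descendant x) (inB-injective (trans (sym eq) (parent-inB (suc w)))) dy)

  module _ {n} (βA : Fin (suc kA) → Subset n) (βB : Fin (suc kB) → Subset n) where

    LabelsBelow-inA : ∀ x a → x ≢ zero → LabelsBelow (glue βA βB) (inA x) a ⇔ A.LabelsBelow βA x a
    LabelsBelow-inA x a x≢0 = mk⇔ to-A from-A
      where
      to-A : LabelsBelow (glue βA βB) (inA x) a → A.LabelsBelow βA x a
      to-A (ℓ , childless , d , a∈) with Descendant-inA⁻ x≢0 d
      ... | (y , refl , dy) = y , trans (sym (children-inA≢root y (A.Descendant≢root dy x≢0))) childless , dy ,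
                              subst (a ∈_) (glue-inA βA βB y) a∈
      from-A : A.LabelsBelow βA x a → LabelsBelow (glue βA βB) (inA x) a
      from-A (y , childless , dy , a∈) = inA y , trans (children-inA≢root y (A.Descendant≢root dy x≢0)) childless ,
                                    Descendant-inA⁺ dy , subst (a ∈_) (sym (glue-inA βA βB y)) a∈

    LabelsBelow-inB : ∀ y a → LabelsBelow (glue βA βB) (inB y) a ⇔ B.LabelsBelow βB y a
    LabelsBelow-inB y a = mk⇔ to-B from-B
      where
      to-B : LabelsBelow (glue βA βB) (inB y) a → B.LabelsBelow βB y a
      to-B (ℓ , childless , d , a∈) with Descendant-inB⁻ d
      ... | (z , refl , dz) = z , trans (sym (children-inB z)) childless , dz , subst (a ∈_) (glue-inB βA βB z) a∈
      from-B : B.LabelsBelow βB y a → LabelsBelow (glue βA βB) (inB y) a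
      from-B (z , childless , dz , a∈) = inB z , trans (children-inB z) childless , Descendant-inB⁺ dz ,
                                    subst (a ∈_) (sym (glue-inB βA βB z)) a∈

    ChildlessNonRootOfA : Fin n → Set
    ChildlessNonRootOfA a = Σ[ ℓ ∈ Fin (suc kA) ] (ℓ ≢ zero × A.children ℓ ≡ 0 × a ∈ βA ℓ)

    LabelsBelow-root : ∀ a → LabelsBelow (glue βA βB) zero a ⇔ (ChildlessNonRootOfA a ⊎ B.LabelsBelow βB zero a)
    LabelsBelow-root a = mk⇔ split unsplit
      where
      split : LabelsBelow (glue βA βB) zero a → ChildlessNonRootOfA a ⊎ B.LabelsBelow βB zero a
      split (ℓ , childless , _ , a∈) with view ℓ
      ... | inj₁ (zero , refl)  = ⊥-elim (ℕₚ.0≢1+n (trans (sym childless) children-root))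
      ... | inj₁ (suc y , refl) = inj₁ (suc y , (λ ()) , trans (sym (children-inA≢root (suc y) (λ ()))) childless ,
                                         subst (a ∈_) (glue-inA βA βB (suc y)) a∈)
      ... | inj₂ (y , refl)     = inj₂ (y , trans (sym (children-inB y)) childless , B.root-ancestor y ,
                                        subst (a ∈_) (glue-inB βA βB y) a∈)
      unsplit : ChildlessNonRootOfA a ⊎ B.LabelsBelow βB zero a → LabelsBelow (glue βA βB) zero a
      unsplit (inj₁ (ℓ , ℓ≢0 , childless , a∈)) =
        inA ℓ , trans (children-inA≢root ℓ ℓ≢0) childless , root-ancestor (inA ℓ) ,
        subst (a ∈_) (sym (glue-inA βA βB ℓ)) a∈
      unsplit (inj₂ (y , childless , _ , a∈)) =
        inB y , trans (children-inB y) childless , root-ancestor (inB y) ,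
        subst (a ∈_) (sym (glue-inB βA βB y)) a∈

-- Binary bracketings of subsets of A: the combinatorial content of a
-- branch decomposition.  A bracketing with leaves X₁,…,X_r has the
-- brackets ⋃ L (the union of the leaves below a node).

data Bracketing (n : ℕ) : Set where
  leaf : Subset n → Bracketing n
  node : Bracketing n → Bracketing n → Bracketing n

⋃B : ∀ {n} → Bracketing n → Subset n
⋃B (leaf Y)   = Y
⋃B (node L R) = ⋃B L ∪ ⋃B R

point : PointerTree 0
point = record { parent = id ; parent< = λ { zero u≢0 → ⊥-elim (u≢0 refl) } }

module Scenario {n : ℕ} (𝒫 : Family n → Set) (𝒮 : Subset n → Set) where

  IsCut : Subset n → Set₁
  IsCut S = pairF S (∁ S) ∈𝒫 𝒫

  Valid : Bracketing n → Set₁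
  Valid (leaf Y)   = 𝒮 Y × IsCut Y
  Valid (node L R) = Valid L × Valid R × Disjoint (⋃B L) (⋃B R) × IsCut (⋃B L ∪ ⋃B R)

  -- What a branch decomposition needs: the topmost bracket of a node
  -- (which will be all of A) need not be a cut.
  ValidBelowTop : Bracketing n → Set₁
  ValidBelowTop (leaf Y)   = Valid (leaf Y)
  ValidBelowTop (node L R) = Valid L × Valid R × Disjoint (⋃B L) (⋃B R)

  module _ (scenario : IsScenario 𝒫 𝒮) where

    open IsScenario scenario using (partitions; SC1)

    -- By (SC1), a union of blocks of a partition in 𝒫 is a cut: {S, Sᶜ} is
    -- coarser than P, since a block meeting Sᶜ lies inside Sᶜ.
    union-of-blocks-is-cut : ∀ P → 𝒫 P → ∀ S → UnionOfBlocks P S → IsCut S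
    union-of-blocks-is-cut P 𝒫P S blocks = SC1 P (pairF S (∁ S)) 𝒫P (complement-pair-partition S) coarser
      where
      outside-block : ∀ {a Z} → a ∈ ∁ S → P Z → a ∈ Z → ∀ b → b ∈ Z → b ∉ S
      outside-block a∈∁S PZ a∈Z b b∈Z b∈S =
        let (Z' , PZ' , b∈Z' , Z'⊆S) = blocks b b∈S
        in Subₚ.x∈∁p⇒x∉p a∈∁S (Z'⊆S (subst (_ ∈_) (same-block (partitions P 𝒫P) PZ PZ' b∈Z b∈Z') a∈Z))
      coarser : Coarser (pairF S (∁ S)) P
      coarser X (inj₁ refl) = (λ Z → P Z × Z ⊆ S) , (λ _ → proj₁) , λ a →
        mk⇔ (λ a∈S → let (Z , PZ , a∈Z , Z⊆S) = blocks a a∈S in Z , (PZ , λ {b} → Z⊆S {b}) , a∈Z)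
            (λ (Z , (_ , Z⊆S) , a∈Z) → Z⊆S a∈Z)
      coarser X (inj₂ refl) = (λ Z → P Z × (∀ b → b ∈ Z → b ∉ S)) , (λ _ → proj₁) , λ a →
        mk⇔ (λ a∈∁S → let (Z , PZ , a∈Z) = proj₂ (partitions P 𝒫P) a in Z , (PZ , outside-block a∈∁S PZ a∈Z) , a∈Z)
            (λ (Z , (_ , Z∩S=∅) , a∈Z) → Subₚ.x∉p⇒x∈∁p (Z∩S=∅ a a∈Z))

    -- Adding a block of P to a union of blocks of P: the block either lies
    -- inside the union already, or is disjoint from it and the enlarged
    -- union is again a cut.
    absorb-block : ∀ {P} → 𝒫 P → ∀ {B Bw} → Valid B → UnionOfBlocks P (⋃B B) → Valid Bw → P (⋃B Bw)
                   → Σ[ B' ∈ Bracketing n ] (Valid B' × UnionOfBlocks P (⋃B B')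
                                             × (∀ a → a ∈ ⋃B B' ⇔ (a ∈ ⋃B Bw ⊎ a ∈ ⋃B B)))
    absorb-block {P} 𝒫P {B} {Bw} valid blocks valid-w block-w
      with block-inside-or-disjoint (partitions P 𝒫P) block-w blocks
    ... | inj₁ Bw⊆B     = B , valid , blocks , λ a → mk⇔ inj₂ [ (λ a∈ → Bw⊆B a∈) , id ]′
    ... | inj₂ disjoint =
          node Bw B , (valid-w , valid , disjoint , union-of-blocks-is-cut P 𝒫P _ blocks′) , blocks′ ,
          λ a → ∈-∪⇔ (⋃B Bw) (⋃B B)
      where
      blocks′ : UnionOfBlocks P (⋃B Bw ∪ ⋃B B)
      blocks′ a a∈ with Subₚ.x∈p∪q⁻ (⋃B Bw) (⋃B B) a∈
      ... | inj₁ a∈w = ⋃B Bw , block-w , a∈w , Subₚ.p⊆p∪q (⋃B B)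
      ... | inj₂ a∈B = let (Z , PZ , a∈Z , Z⊆B) = blocks a a∈B in Z , PZ , a∈Z , Subₚ.q⊆p∪q (⋃B Bw) (⋃B B) ∘ Z⊆B

  Valid⇒ValidBelowTop : ∀ B → Valid B → ValidBelowTop B
  Valid⇒ValidBelowTop (leaf Y)   valid                    = valid
  Valid⇒ValidBelowTop (node L R) (vL , vR , disjoint , _) = vL , vR , disjoint

  -- A bracketing realised by a rooted tree in which every vertex has 0 or
  -- 2 children, the childless vertices carry the leaves, and each vertex
  -- carries the bracket of the leaves below it.
  record Realisation (B : Bracketing n) : Set₁ where
    field
      k    : ℕ
      tree : PointerTree k
    open PointerTreeGraph tree
    field
      label           : Vertex → Subset n
      binary          : ∀ u → children u ≡ 0 ⊎ children u ≡ 2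
      leaves-in-𝒮     : ∀ u → children u ≡ 0 → 𝒮 (label u)
      leaves-disjoint : ∀ u v → children u ≡ 0 → children v ≡ 0 → u ≢ v → Disjoint (label u) (label v)
      bracket         : Vertex → Subset n
      bracket-spec    : ∀ u a → a ∈ bracket u ⇔ LabelsBelow label u a
      bracket-cut     : ∀ u → IsCut (bracket u)
      bracket-root    : bracket zero ≡ ⋃B B

    ⋃B⇔leaves : ∀ a → a ∈ ⋃B B ⇔ LabelsBelow label zero a
    ⋃B⇔leaves a = subst (λ X → a ∈ X ⇔ LabelsBelow label zero a) bracket-root (bracket-spec zero a)

    leaf⊆⋃B : ∀ ℓ a → children ℓ ≡ 0 → a ∈ label ℓ → a ∈ ⋃B B
    leaf⊆⋃B ℓ a childless a∈ = from (⋃B⇔leaves a) (ℓ , childless , root-ancestor ℓ , a∈)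

  realise-leaf : ∀ Y → 𝒮 Y → IsCut Y → Realisation (leaf Y)
  realise-leaf Y Y∈𝒮 Y-cut = record
    { k = 0 ; tree = point ; label = λ _ → Y
    ; binary          = λ { zero → inj₁ refl }
    ; leaves-in-𝒮     = λ _ _ → Y∈𝒮
    ; leaves-disjoint = λ { zero zero _ _ 0≢0 → ⊥-elim (0≢0 refl) }
    ; bracket         = λ _ → Y
    ; bracket-spec    = λ { zero a → mk⇔ (λ a∈ → zero , refl , PointerTreeGraph.self , a∈)
                                         (λ { (zero , _ , _ , a∈) → a∈ }) }
    ; bracket-cut     = λ _ → Y-cut
    ; bracket-root    = refl }

  -- Realising a node: a fresh root whose two children are the roots of
  -- realisations of the two sides.
  module RealiseNode {L R : Bracketing n} (ℒ : Realisation L) (ℛ : Realisation R)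
                     (disjoint : Disjoint (⋃B L) (⋃B R)) (top-cut : IsCut (⋃B L ∪ ⋃B R)) where

    module ℒ = Realisation ℒ
    module ℛ = Realisation ℛ
    module TL = PointerTreeGraph ℒ.tree
    module TR = PointerTreeGraph ℛ.tree
    module S₁ = Glue point ℒ.tree
    module S₂ = Glue S₁.glued ℛ.tree
    open PointerTreeGraph S₂.glued

    -- the left tree below the new root, labelled (the root carries no leaf)
    labelₗ : Fin (suc S₁.k) → Subset n
    labelₗ = S₁.glue (λ _ → Sub.⊥) ℒ.label

    bracketₗ : Fin (suc S₁.k) → Subset n
    bracketₗ = S₁.glue (λ _ → ⋃B L ∪ ⋃B R) ℒ.bracket

    label : Vertex → Subset n
    label = S₂.glue labelₗ ℛ.label

    bracket : Vertex → Subset n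
    bracket = S₂.glue bracketₗ ℛ.bracket

    inL : Fin (suc ℒ.k) → Vertex
    inL y = S₂.inA (S₁.inB y)

    inR : Fin (suc ℛ.k) → Vertex
    inR = S₂.inB

    data Side (u : Vertex) : Set where
      root     : u ≡ zero → Side u
      on-left  : ∀ y → u ≡ inL y → Side u
      on-right : ∀ z → u ≡ inR z → Side u

    side : ∀ u → Side u
    side u with S₂.view u
    ... | inj₂ (z , u≡) = on-right z u≡
    ... | inj₁ (x , u≡) with S₁.view x
    ...   | inj₁ (zero , x≡) = root (trans u≡ (cong S₂.inA x≡))
    ...   | inj₂ (y , x≡)    = on-left y (trans u≡ (cong S₂.inA x≡))

    children-inL : ∀ y → children (inL y) ≡ TL.children y
    children-inL y = trans (S₂.children-inA≢root (S₁.inB y) (λ ())) (S₁.children-inB y)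

    children-root : children zero ≡ 2
    children-root = trans S₂.children-root (cong suc S₁.children-root)

    label-inL : ∀ y → label (inL y) ≡ ℒ.label y
    label-inL y = trans (S₂.glue-inA labelₗ ℛ.label (S₁.inB y)) (S₁.glue-inB (λ _ → Sub.⊥) ℒ.label y)

    bracket-inL : ∀ y → bracket (inL y) ≡ ℒ.bracket y
    bracket-inL y = trans (S₂.glue-inA bracketₗ ℛ.bracket (S₁.inB y)) (S₁.glue-inB (λ _ → ⋃B L ∪ ⋃B R) ℒ.bracket y)

    label-inR : ∀ z → label (inR z) ≡ ℛ.label z
    label-inR = S₂.glue-inB labelₗ ℛ.label

    bracket-inR : ∀ z → bracket (inR z) ≡ ℛ.bracket z
    bracket-inR = S₂.glue-inB bracketₗ ℛ.bracket

    bracket-root : bracket zero ≡ ⋃B L ∪ ⋃B R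
    bracket-root = trans (S₂.glue-inA bracketₗ ℛ.bracket zero) (S₁.glue-inA (λ _ → ⋃B L ∪ ⋃B R) ℒ.bracket zero)

    below-inL : ∀ y a → LabelsBelow label (inL y) a ⇔ TL.LabelsBelow ℒ.label y a
    below-inL y a = ⇔-trans (S₂.LabelsBelow-inA labelₗ ℛ.label (S₁.inB y) a (λ ()))
                            (S₁.LabelsBelow-inB (λ _ → Sub.⊥) ℒ.label y a)

    below-root : ∀ a → LabelsBelow label zero a ⇔ (TL.LabelsBelow ℒ.label zero a ⊎ TR.LabelsBelow ℛ.label zero a)
    below-root a = ⇔-trans (S₂.LabelsBelow-root labelₗ ℛ.label a) (mk⇔ to-L from-L ⊎-⇔ mk⇔ id id)
      where
      to-L : S₂.ChildlessNonRootOfA labelₗ ℛ.label a → TL.LabelsBelow ℒ.label zero a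
      to-L (ℓ , ℓ≢0 , childless , a∈) with S₁.view ℓ
      ... | inj₁ (zero , refl) = ⊥-elim (ℓ≢0 refl)
      ... | inj₂ (y , refl)    = y , trans (sym (S₁.children-inB y)) childless , TL.root-ancestor y ,
                                 subst (a ∈_) (S₁.glue-inB (λ _ → Sub.⊥) ℒ.label y) a∈
      from-L : TL.LabelsBelow ℒ.label zero a → S₂.ChildlessNonRootOfA labelₗ ℛ.label a
      from-L (y , childless , _ , a∈) = S₁.inB y , (λ ()) , trans (S₁.children-inB y) childless ,
                                        subst (a ∈_) (sym (S₁.glue-inB (λ _ → Sub.⊥) ℒ.label y)) a∈

    data Childless (u : Vertex) : Set where
      left-leaf  : ∀ y → u ≡ inL y → TL.children y ≡ 0 → Childless u
      right-leaf : ∀ z → u ≡ inR z → TR.children z ≡ 0 → Childless u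

    childless-side : ∀ u → children u ≡ 0 → Childless u
    childless-side u childless with side u
    ... | root refl       = ⊥-elim (ℕₚ.0≢1+n (trans (sym childless) children-root))
    ... | on-left y refl  = left-leaf y refl (trans (sym (children-inL y)) childless)
    ... | on-right z refl = right-leaf z refl (trans (sym (S₂.children-inB z)) childless)

    binary : ∀ u → children u ≡ 0 ⊎ children u ≡ 2
    binary u with side u
    ... | root refl       = inj₂ children-root
    ... | on-left y refl  rewrite children-inL y     = ℒ.binary y
    ... | on-right z refl rewrite S₂.children-inB z = ℛ.binary z

    leaves-in-𝒮 : ∀ u → children u ≡ 0 → 𝒮 (label u)
    leaves-in-𝒮 u childless with childless-side u childless
    ... | left-leaf y refl c  rewrite label-inL y = ℒ.leaves-in-𝒮 y c
    ... | right-leaf z refl c rewrite label-inR z = ℛ.leaves-in-𝒮 z c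

    in-left : ∀ {a} y → a ∈ label (inL y) → a ∈ ℒ.label y
    in-left {a} y = subst (a ∈_) (label-inL y)

    in-right : ∀ {a} z → a ∈ label (inR z) → a ∈ ℛ.label z
    in-right {a} z = subst (a ∈_) (label-inR z)

    leaves-disjoint : ∀ u v → children u ≡ 0 → children v ≡ 0 → u ≢ v → Disjoint (label u) (label v)
    leaves-disjoint u v cu cv u≢v a a∈u a∈v with childless-side u cu | childless-side v cv
    ... | left-leaf y refl cy | left-leaf y' refl cy' =
          ℒ.leaves-disjoint y y' cy cy' (u≢v ∘ cong inL) a (in-left y a∈u) (in-left y' a∈v)
    ... | right-leaf z refl cz | right-leaf z' refl cz' =
          ℛ.leaves-disjoint z z' cz cz' (u≢v ∘ cong inR) a (in-right z a∈u) (in-right z' a∈v)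
    ... | left-leaf y refl cy | right-leaf z refl cz =
          disjoint a (ℒ.leaf⊆⋃B y a cy (in-left y a∈u)) (ℛ.leaf⊆⋃B z a cz (in-right z a∈v))
    ... | right-leaf z refl cz | left-leaf y refl cy =
          disjoint a (ℒ.leaf⊆⋃B y a cy (in-left y a∈v)) (ℛ.leaf⊆⋃B z a cz (in-right z a∈u))

    bracket-spec : ∀ u a → a ∈ bracket u ⇔ LabelsBelow label u a
    bracket-spec u a with side u
    ... | root refl rewrite bracket-root =
          ⇔-trans (∈-∪⇔ (⋃B L) (⋃B R)) (⇔-trans (ℒ.⋃B⇔leaves a ⊎-⇔ ℛ.⋃B⇔leaves a) (⇔-sym (below-root a)))
    ... | on-left y refl rewrite bracket-inL y = ⇔-trans (ℒ.bracket-spec y a) (⇔-sym (below-inL y a))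
    ... | on-right z refl rewrite bracket-inR z =
          ⇔-trans (ℛ.bracket-spec z a) (⇔-sym (S₂.LabelsBelow-inB labelₗ ℛ.label z a))

    bracket-cut : ∀ u → IsCut (bracket u)
    bracket-cut u with side u
    ... | root refl       rewrite bracket-root  = top-cut
    ... | on-left y refl  rewrite bracket-inL y = ℒ.bracket-cut y
    ... | on-right z refl rewrite bracket-inR z = ℛ.bracket-cut z

    realisation : Realisation (node L R)
    realisation = record
      { k = S₂.k ; tree = S₂.glued ; label = label ; binary = binary
      ; leaves-in-𝒮 = leaves-in-𝒮 ; leaves-disjoint = leaves-disjoint
      ; bracket = bracket ; bracket-spec = bracket-spec ; bracket-cut = bracket-cut
      ; bracket-root = bracket-root }

  realise : ∀ B → Valid B → Realisation B
  realise (leaf Y)   (Y∈𝒮 , Y-cut)               = realise-leaf Y Y∈𝒮 Y-cut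
  realise (node L R) (vL , vR , disjoint , cut) =
    RealiseNode.realisation (realise L vL) (realise R vR) disjoint cut

  single-leaf-decomposition : ∀ Y → 𝒮 Y → (∀ a → a ∈ Y) → BranchDecomposition 𝒫 𝒮
  single-leaf-decomposition Y Y∈𝒮 covers = record
    { m = 1 ; T = graph ; β = λ _ → Y ; tree = is-tree
    ; cubic            = λ { zero ¬leaf → ⊥-elim (¬leaf is-leaf) }
    ; leaves-in-𝒮      = λ _ _ → Y∈𝒮
    ; leaves-partition = (λ { X Z (zero , _ , refl) (zero , _ , refl) X≢Z _ _ _ → X≢Z refl })
                       , (λ a → Y , (zero , is-leaf , refl) , covers a)
    ; edges            = λ { zero zero adj → ⊥-elim (irreflexive zero adj) } }
    where
    open PointerTreeGraph point
    is-leaf : IsLeaf graph zero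
    is-leaf = subst (_≤ 1) (sym (degree≡ zero)) z≤n

  -- A node whose two sides are realised and which covers A is a branch
  -- decomposition: glue the root of the right side below the root of the
  -- left side.  Every edge then joins a non-root vertex u to its parent,
  -- and its cut is {bracket u, (bracket u)ᶜ}.
  module BranchFromNode {L R : Bracketing n} (ℒ : Realisation L) (ℛ : Realisation R)
                        (disjoint : Disjoint (⋃B L) (⋃B R)) (covers : ∀ a → a ∈ ⋃B L ∪ ⋃B R) where

    module ℒ = Realisation ℒ
    module ℛ = Realisation ℛ
    module TL = PointerTreeGraph ℒ.tree
    module TR = PointerTreeGraph ℛ.tree
    module S = Glue ℒ.tree ℛ.tree
    open PointerTreeGraph S.glued

    label : Vertex → Subset n
    label = S.glue ℒ.label ℛ.label

    bracket : Vertex → Subset n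
    bracket = S.glue ℒ.bracket ℛ.bracket

    -- A vertex has one neighbour more than it has children in its part (the
    -- root of A gains the root of B), so leaves are childless in their part.
    degree-inA : ∀ x → degree graph (S.inA x) ≡ suc (TL.children x)
    degree-inA zero    = trans (degree≡ zero) S.children-root
    degree-inA (suc x) = trans (degree≡ (S.inA (suc x))) (cong suc (S.children-inA≢root (suc x) (λ ())))

    degree-inB : ∀ z → degree graph (S.inB z) ≡ suc (TR.children z)
    degree-inB z = trans (degree≡ (S.inB z)) (cong suc (S.children-inB z))

    leaf-inA : ∀ x → IsLeaf graph (S.inA x) ⇔ (TL.children x ≡ 0)
    leaf-inA x = leaf⇔ graph (S.inA x) (degree-inA x)

    leaf-inB : ∀ z → IsLeaf graph (S.inB z) ⇔ (TR.children z ≡ 0)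
    leaf-inB z = leaf⇔ graph (S.inB z) (degree-inB z)

    in-left : ∀ {a} y → a ∈ label (S.inA y) → a ∈ ℒ.label y
    in-left {a} y = subst (a ∈_) (S.glue-inA ℒ.label ℛ.label y)

    in-right : ∀ {a} z → a ∈ label (S.inB z) → a ∈ ℛ.label z
    in-right {a} z = subst (a ∈_) (S.glue-inB ℒ.label ℛ.label z)

    leaves-disjoint : ∀ ℓ ℓ' → IsLeaf graph ℓ → IsLeaf graph ℓ' → ℓ ≢ ℓ' → Disjoint (label ℓ) (label ℓ')
    leaves-disjoint ℓ ℓ' leaf-ℓ leaf-ℓ' ℓ≢ℓ' a a∈ a∈' with S.view ℓ | S.view ℓ'
    ... | inj₁ (y , refl) | inj₁ (y' , refl) =
          ℒ.leaves-disjoint y y' (to (leaf-inA y) leaf-ℓ) (to (leaf-inA y') leaf-ℓ') (ℓ≢ℓ' ∘ cong S.inA) a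
            (in-left y a∈) (in-left y' a∈')
    ... | inj₂ (z , refl) | inj₂ (z' , refl) =
          ℛ.leaves-disjoint z z' (to (leaf-inB z) leaf-ℓ) (to (leaf-inB z') leaf-ℓ') (ℓ≢ℓ' ∘ cong S.inB) a
            (in-right z a∈) (in-right z' a∈')
    ... | inj₁ (y , refl) | inj₂ (z , refl) =
          disjoint a (ℒ.leaf⊆⋃B y a (to (leaf-inA y) leaf-ℓ) (in-left y a∈))
                     (ℛ.leaf⊆⋃B z a (to (leaf-inB z) leaf-ℓ') (in-right z a∈'))
    ... | inj₂ (z , refl) | inj₁ (y , refl) =
          disjoint a (ℒ.leaf⊆⋃B y a (to (leaf-inA y) leaf-ℓ') (in-left y a∈'))
                     (ℛ.leaf⊆⋃B z a (to (leaf-inB z) leaf-ℓ) (in-right z a∈))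

    leaves-cover : ∀ a → Σ[ ℓ ∈ Vertex ] (IsLeaf graph ℓ × a ∈ label ℓ)
    leaves-cover a with Subₚ.x∈p∪q⁻ (⋃B L) (⋃B R) (covers a)
    ... | inj₁ a∈L = let (y , childless , _ , a∈) = to (ℒ.⋃B⇔leaves a) a∈L
                     in S.inA y , from (leaf-inA y) childless , subst (a ∈_) (sym (S.glue-inA ℒ.label ℛ.label y)) a∈
    ... | inj₂ a∈R = let (z , childless , _ , a∈) = to (ℛ.⋃B⇔leaves a) a∈R
                     in S.inB z , from (leaf-inB z) childless , subst (a ∈_) (sym (S.glue-inB ℒ.label ℛ.label z)) a∈

    bracket-spec : ∀ u → u ≢ zero → ∀ a
                   → a ∈ bracket u ⇔ (Σ[ ℓ ∈ Vertex ] (IsLeaf graph ℓ × Descendant u ℓ × a ∈ label ℓ))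
    bracket-spec u u≢0 a with S.view u
    ... | inj₁ (zero , refl) = ⊥-elim (u≢0 refl)
    ... | inj₁ (suc x , refl) rewrite S.glue-inA ℒ.bracket ℛ.bracket (suc x) =
          ⇔-trans (ℒ.bracket-spec (suc x) a)
            (⇔-trans (⇔-sym (S.LabelsBelow-inA ℒ.label ℛ.label (suc x) a (λ ()))) (LabelsBelow⇔leaves label _ a u≢0))
    ... | inj₂ (z , refl) rewrite S.glue-inB ℒ.bracket ℛ.bracket z =
          ⇔-trans (ℛ.bracket-spec z a)
            (⇔-trans (⇔-sym (S.LabelsBelow-inB ℒ.label ℛ.label z a)) (LabelsBelow⇔leaves label _ a u≢0))

    bracket-cut : ∀ u → IsCut (bracket u)
    bracket-cut u with S.view u
    ... | inj₁ (x , refl) rewrite S.glue-inA ℒ.bracket ℛ.bracket x = ℒ.bracket-cut x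
    ... | inj₂ (z , refl) rewrite S.glue-inB ℒ.bracket ℛ.bracket z = ℛ.bracket-cut z

    child-edge-cut : ∀ u → u ≢ zero → P-edge graph label u (PointerTree.parent S.glued u) ∈𝒫 𝒫
    child-edge-cut u u≢0 =
      ∈𝒫-resp-≈F (λ X → ⇔-sym (EdgeCut.edge-cut u u≢0 label (bracket u) (bracket-spec u u≢0)
                                                  leaves-disjoint leaves-cover X))
                 (bracket-cut u)

    edge-cut : ∀ u v → Adj graph u v → P-edge graph label u v ∈𝒫 𝒫
    edge-cut u v adj with to (Adj⇔Edge u v) adj
    ... | inj₁ (u≢0 , refl) = child-edge-cut u u≢0
    ... | inj₂ (v≢0 , refl) = ∈𝒫-resp-≈F (P-edge-swap graph label v u) (child-edge-cut v v≢0)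

    -- Inner vertices have two children and a parent.
    cubic : IsCubic graph
    cubic t ¬leaf with S.view t
    ... | inj₁ (y , refl) with ℒ.binary y
    ...   | inj₁ none = ⊥-elim (¬leaf (from (leaf-inA y) none))
    ...   | inj₂ two  = trans (degree-inA y) (cong suc two)
    cubic t ¬leaf | inj₂ (z , refl) with ℛ.binary z
    ...   | inj₁ none = ⊥-elim (¬leaf (from (leaf-inB z) none))
    ...   | inj₂ two  = trans (degree-inB z) (cong suc two)

    leaves-in-𝒮 : ∀ ℓ → IsLeaf graph ℓ → 𝒮 (label ℓ)
    leaves-in-𝒮 ℓ is-leaf with S.view ℓ
    ... | inj₁ (y , refl) rewrite S.glue-inA ℒ.label ℛ.label y = ℒ.leaves-in-𝒮 y (to (leaf-inA y) is-leaf)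
    ... | inj₂ (z , refl) rewrite S.glue-inB ℒ.label ℛ.label z = ℛ.leaves-in-𝒮 z (to (leaf-inB z) is-leaf)

    decomposition : BranchDecomposition 𝒫 𝒮
    decomposition = record
      { m = suc S.k ; T = graph ; β = label ; tree = is-tree ; cubic = cubic
      ; leaves-in-𝒮 = leaves-in-𝒮
      ; leaves-partition = blocks-disjoint , λ a → let (ℓ , is-leaf , a∈) = leaves-cover a
                                                   in label ℓ , (ℓ , is-leaf , refl) , a∈
      ; edges = edge-cut }
      where
      blocks-disjoint : ∀ X Z → leafImage graph label X → leafImage graph label Z → X ≢ Z → Disjoint X Z
      blocks-disjoint X Z (ℓ , leaf-ℓ , refl) (ℓ' , leaf-ℓ' , refl) X≢Z =
        leaves-disjoint ℓ ℓ' leaf-ℓ leaf-ℓ' (X≢Z ∘ cong label)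

  branch-decomposition : ∀ B → ValidBelowTop B → (∀ a → a ∈ ⋃B B) → BranchDecomposition 𝒫 𝒮
  branch-decomposition (leaf Y)   (Y∈𝒮 , _)           covers = single-leaf-decomposition Y Y∈𝒮 covers
  branch-decomposition (node L R) (vL , vR , disjoint) covers =
    BranchFromNode.decomposition (realise L vL) (realise R vR) disjoint covers

-- Since T has
-- no cycles, two neighbours of c are never joined in T − c; this is what
-- identifies the components of T − c with the neighbours of c.
module TreeWalks {m : ℕ} (T : Graph m) (T-sym : Symmetric T) (T-irr : Irreflexive T) (T-acyclic : ¬ HasCycle T) where

  open import Data.List.Membership.DecPropositional (_≟_ {m}) using (_∈?_)

  Avoiding : Fin m → Fin m → Fin m → Set
  Avoiding = StepAvoidNode T

  neighbour≢ : ∀ {c w} → Adj T c w → w ≢ c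
  neighbour≢ {c} cw refl = T-irr c cw

  walk-end≢ : ∀ {c w y} → Reach (Avoiding c) w y → w ≢ c → y ≢ c
  walk-end≢ here                      w≢c = w≢c
  walk-end≢ (there (_ , _ , z≢c) walk) _   = walk-end≢ walk z≢c

  suffix-from : ∀ {P : Fin m → Set} x y ys → x List.∈ (y ∷ ys) → Unique (y ∷ ys) → Linked (Adj T) (y ∷ ys)
                → All P (y ∷ ys)
                → Σ[ zs ∈ List (Fin m) ] (Unique (x ∷ zs) × Linked (Adj T) (x ∷ zs) × All P (x ∷ zs)
                                          × lastOf x zs ≡ lastOf y ys)
  suffix-from x y ys (here refl) distinct linked all = ys , distinct , linked , all , refl
  suffix-from x y (y' ∷ ys') (there x∈) (_ ∷ distinct) (_ ∷ linked) (_ ∷ all) =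
    suffix-from x y' ys' x∈ distinct linked all

  prefix-to : ∀ w y ys → w List.∈ (y ∷ ys) → Unique (y ∷ ys) → Linked (Adj T) (y ∷ ys)
              → Σ[ zs ∈ List (Fin m) ] (Unique (y ∷ zs) × Linked (Adj T) (y ∷ zs) × lastOf y zs ≡ w
                                        × (∀ {z} → z List.∈ (y ∷ zs) → z List.∈ (y ∷ ys)))
  prefix-to w y ys (here refl) _ _ = [] , ([] ∷ []) , [-] , refl , λ { (here z≡y) → here z≡y }
  prefix-to w y (y' ∷ ys') (there w∈) (y∉ ∷ distinct) (yy' ∷ linked) with prefix-to w y' ys' w∈ distinct linked
  ... | (zs , distinct' , linked' , ends , ⊆ys) =
        y' ∷ zs , (All.tabulate (All.lookup y∉ ∘ ⊆ys) ∷ distinct') , (yy' ∷ linked') , ends ,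
        λ { (here z≡y) → here z≡y ; (there z∈) → there (⊆ys z∈) }

  walk⇒path : ∀ {c x y} → Reach (Avoiding c) x y → x ≢ c
              → Σ[ xs ∈ List (Fin m) ] (Unique (x ∷ xs) × Linked (Adj T) (x ∷ xs) × All (_≢ c) (x ∷ xs)
                                        × lastOf x xs ≡ y)
  walk⇒path here x≢c = [] , ([] ∷ []) , [-] , (x≢c ∷ []) , refl
  walk⇒path {x = x} (there {v = x₁} (adj , x≢c , x₁≢c) walk) _ with walk⇒path walk x₁≢c
  ... | (xs , distinct , linked , avoids , ends) with x ∈? (x₁ ∷ xs)
  ...   | yes x∈ = let (zs , distinct' , linked' , avoids' , ends') = suffix-from x x₁ xs x∈ distinct linked avoids
                   in zs , distinct' , linked' , avoids' , trans ends' ends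
  ...   | no x∉  = x₁ ∷ xs , (¬Any⇒All¬ _ x∉ ∷ distinct) , (adj ∷ linked) , (x≢c ∷ avoids) , ends

  no-return : ∀ {c v w} → Adj T c v → Adj T c w → w ≢ v → ¬ Reach (Avoiding c) w v
  no-return {c} {v} {w} cv cw w≢v walk with walk⇒path walk (neighbour≢ cw)
  ... | ([] , _ , _ , _ , w≡v) = w≢v w≡v
  ... | (x ∷ xs , distinct , linked , avoids , ends) =
        T-acyclic (c , w ∷ x ∷ xs , s≤s (s≤s z≤n) , (All.map (λ z≢c c≡z → z≢c (sym c≡z)) avoids ∷ distinct) ,
                   (cw ∷ Linked-snoc linked (subst (λ z → Adj T z c) (sym ends) (T-sym c v cv))))

  off-path : ∀ {c v vs w} → Unique (c ∷ v ∷ vs) → Linked (Adj T) (c ∷ v ∷ vs) → Adj T c w → w ≢ v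
             → ¬ (w List.∈ (v ∷ vs))
  off-path {c} {v} {vs} {w} (c∉ ∷ distinct) (cv ∷ linked) cw w≢v w∈ with prefix-to w v vs w∈ distinct linked
  ... | ([] , _ , _ , v≡w , _) = w≢v (sym v≡w)
  ... | (z ∷ zs , distinct' , linked' , ends , ⊆vs) =
        T-acyclic (c , v ∷ z ∷ zs , s≤s (s≤s z≤n) , (All.tabulate (All.lookup c∉ ∘ ⊆vs) ∷ distinct') ,
                   (cv ∷ Linked-snoc linked' (subst (λ q → Adj T q c) (sym ends) (T-sym c w cw))))

  last-departure : ∀ {Q : Fin m → Fin m → Set} → (∀ {x y} → Q x y → Adj T x y) → ∀ {c ℓ} → Reach Q c ℓ
                   → (ℓ ≡ c) ⊎ (Σ[ w ∈ Fin m ] (Q c w × Reach (Avoiding c) w ℓ))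
  last-departure {Q} Q⊆T {c} = go (inj₁ refl)
    where
    go : ∀ {y ℓ} → (y ≡ c) ⊎ (Σ[ w ∈ Fin m ] (Q c w × Reach (Avoiding c) w y)) → Reach Q y ℓ
         → (ℓ ≡ c) ⊎ (Σ[ w ∈ Fin m ] (Q c w × Reach (Avoiding c) w ℓ))
    go so-far here = so-far
    go (inj₁ refl) (there {v = z} q walk) = go (inj₂ (z , q , here)) walk
    go (inj₂ (w , cw , away)) (there {v = z} q walk) with z ≟ c
    ... | yes z≡c = go (inj₁ z≡c) walk
    ... | no z≢c  = go (inj₂ (w , cw , Reach-snoc away (Q⊆T q , walk-end≢ away (neighbour≢ (Q⊆T cw)) , z≢c))) walk

  enter-from : ∀ {c v w ℓ} → Adj T c v → Adj T c w → w ≢ v → Reach (Avoiding c) w ℓ → Reach (Avoiding v) c ℓ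
  enter-from {c} {v} {w} {ℓ} cv cw w≢v walk = there (cw , neighbour≢ cv ∘ sym , w≢v) (avoid-v here walk)
    where
    avoid-v : ∀ {y} → Reach (Avoiding c) w y → Reach (Avoiding c) y ℓ → Reach (Avoiding v) y ℓ
    avoid-v before here = here
    avoid-v before (there s@(adj , _ , _) rest) =
      there (adj , (λ { refl → no-return cv cw w≢v before }) , (λ { refl → no-return cv cw w≢v (Reach-snoc before s) }))
            (avoid-v (Reach-snoc before s) rest)

module FromTreeDecomposition {n : ℕ} {𝒫 : Family n → Set} {𝒮 : Subset n → Set}
                             (scenario : IsScenario 𝒫 𝒮) (td : TreeDecomposition 𝒫 𝒮) where

  open Scenario 𝒫 𝒮
  open IsScenario scenario using (partitions; SC3)
  open TreeDecomposition td

  T-sym : Symmetric T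
  T-sym = proj₁ (proj₂ tree)

  T-connected : Connected T
  T-connected = proj₁ (proj₂ (proj₂ (proj₂ tree)))

  open TreeWalks T T-sym (proj₁ (proj₂ (proj₂ tree))) (proj₂ (proj₂ (proj₂ (proj₂ tree))))

  Below : Fin m → Fin m → Fin n → Set
  Below v c = leafUnion T (Avoiding v) τ c

  Bracketed : Fin m → Fin m → Set₁
  Bracketed v c = Σ[ B ∈ Bracketing n ] (Valid B × (∀ a → a ∈ ⋃B B ⇔ Below v c a))

  Through : Fin m → (Fin m → Set) → List (Fin m) → Fin n → Set
  Through c Ch xs a = Σ[ w ∈ Fin m ] (w List.∈ xs × Ch w × Below c w a)

  below-some-neighbour : ∀ c → ∀ a → (a ∈ τ c × IsLeaf T c) ⊎ Through c (Adj T c) (allFin m) a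
  below-some-neighbour c a with proj₂ leaves-partition a
  ... | (_ , (ℓ , ℓ-leaf , refl) , a∈) with last-departure id (T-connected c ℓ)
  ...   | inj₁ refl             = inj₁ (a∈ , ℓ-leaf)
  ...   | inj₂ (w , cw , walk) = inj₂ (w , ∈-allFin w , cw , ℓ , ℓ-leaf , walk , a∈)

  -- A leaf c of T is alone in its component of T − v.
  leaf-bracketed : ∀ c v → Adj T c v → IsLeaf T c → Bracketed v c
  leaf-bracketed c v cv c-leaf =
    leaf (τ c) , (leaves-in-𝒮 c c-leaf , SC3 (τ c) (leaves-in-𝒮 c c-leaf)) ,
    λ a → mk⇔ (λ a∈ → c , c-leaf , here , a∈) only-c
    where
    only-c : ∀ {a} → Below v c a → a ∈ τ c
    only-c (_ , _ , here , a∈)                  = a∈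
    only-c (_ , _ , there (cz , _ , z≢v) _ , _) = ⊥-elim (z≢v (at-most-one c-leaf cv cz))

  -- Merging, one after the other, the bracketings of the components of
  -- T − c below the neighbours chosen by Ch.  Their sets are blocks of P_c.
  module Merge (c : Fin m) {P : Family n} (𝒫P : 𝒫 P) (P≈ : P ≈F P-node T τ c)
               (Ch : Fin m → Set) (Ch? : Decidable Ch) (Ch⊆N : ∀ {w} → Ch w → Adj T c w)
               (below : ∀ w → Ch w → Bracketed c w) where

    Merged : List (Fin m) → Set₁
    Merged xs = (Σ[ B ∈ Bracketing n ] (Valid B × UnionOfBlocks P (⋃B B)
                                        × (∀ a → a ∈ ⋃B B ⇔ Through c Ch xs a)))
                ⊎ (∀ w → w List.∈ xs → ¬ Ch w)

    component-block : ∀ w → Ch w → (X : Subset n) → (∀ a → a ∈ X ⇔ Below c w a) → P X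
    component-block w ch X X-spec = from (P≈ X) (w , neighbour≢ (Ch⊆N ch) , X-spec)

    skip : ∀ {w xs} → ¬ Ch w → ∀ a → Through c Ch xs a ⇔ Through c Ch (w ∷ xs) a
    skip ¬ch a = mk⇔ (λ (w' , w'∈ , ch , b) → w' , there w'∈ , ch , b)
                     (λ { (w' , here refl , ch , _) → ⊥-elim (¬ch ch) ; (w' , there w'∈ , ch , b) → w' , w'∈ , ch , b })

    add : ∀ {w xs} → Ch w → ∀ a → (Below c w a ⊎ Through c Ch xs a) ⇔ Through c Ch (w ∷ xs) a
    add {w} ch a = mk⇔ [ (λ b → w , here refl , ch , b) , (λ (w' , w'∈ , ch' , b) → w' , there w'∈ , ch' , b) ]′
                       (λ { (w' , here refl , _ , b) → inj₁ b ; (w' , there w'∈ , ch' , b) → inj₂ (w' , w'∈ , ch' , b) })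

    nothing-more : ∀ {xs} → (∀ w → w List.∈ xs → ¬ Ch w) → ∀ a → ¬ Through c Ch xs a
    nothing-more none a (w , w∈ , ch , _) = none w w∈ ch

    merge : ∀ xs → Merged xs
    merge []       = inj₂ λ _ ()
    merge (w ∷ xs) with Ch? w | merge xs
    ... | no ¬ch | inj₂ none = inj₂ λ { _ (here refl) → ¬ch ; w' (there w'∈) → none w' w'∈ }
    ... | no ¬ch | inj₁ (B , valid , blocks , spec) = inj₁ (B , valid , blocks , λ a → ⇔-trans (spec a) (skip ¬ch a))
    ... | yes ch | inj₂ none =
          let (Bw , valid-w , spec-w) = below w ch
          in inj₁ (Bw , valid-w , (λ a a∈ → ⋃B Bw , component-block w ch (⋃B Bw) spec-w , a∈ , id) ,
                   λ a → ⇔-trans (spec-w a) (⇔-trans (mk⇔ inj₁ [ id , ⊥-elim ∘ nothing-more none a ]′) (add ch a)))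
    ... | yes ch | inj₁ (B , valid , blocks , spec) =
          let (Bw , valid-w , spec-w) = below w ch
              (B′ , valid′ , blocks′ , spec′) =
                absorb-block scenario 𝒫P valid blocks valid-w (component-block w ch (⋃B Bw) spec-w)
          in inj₁ (B′ , valid′ , blocks′ , λ a → ⇔-trans (spec′ a) (⇔-trans (spec-w a ⊎-⇔ spec a) (add ch a)))

  split-at-node : ∀ c v → Adj T c v → ¬ IsLeaf T c
                  → ∀ a → Through c (λ w → Adj T c w × w ≢ v) (allFin m) a ⇔ Below v c a
  split-at-node c v cv ¬leaf a =
    mk⇔ (λ (w , _ , (cw , w≢v) , ℓ , ℓ-leaf , walk , a∈) → ℓ , ℓ-leaf , enter-from cv cw w≢v walk , a∈)
        (λ (ℓ , ℓ-leaf , walk , a∈) → leave ℓ-leaf a∈ (last-departure proj₁ walk))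
    where
    leave : ∀ {ℓ} → IsLeaf T ℓ → a ∈ τ ℓ
            → (ℓ ≡ c) ⊎ (Σ[ w ∈ Fin m ] (Avoiding v c w × Reach (Avoiding c) w ℓ))
            → Through c (λ w → Adj T c w × w ≢ v) (allFin m) a
    leave ℓ-leaf a∈ (inj₁ refl)                         = ⊥-elim (¬leaf ℓ-leaf)
    leave ℓ-leaf a∈ (inj₂ (w , (cw , _ , w≢v) , walk)) = w , ∈-allFin w , (cw , w≢v) , _ , ℓ-leaf , walk , a∈

  other-neighbour? : ∀ c v → Decidable (λ w → Adj T c w × w ≢ v)
  other-neighbour? c v w with w Subₚ.∈? T c | w ≟ v
  ... | yes cw | no w≢v  = yes (cw , w≢v)
  ... | yes _  | yes w≡v = no λ (_ , w≢v) → w≢v w≡v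
  ... | no ¬cw | _       = no λ (cw , _) → ¬cw cw

  internal-bracketed : ∀ c v → Adj T c v → ¬ IsLeaf T c → (∀ w → Adj T c w × w ≢ v → Bracketed c w)
                       → Bracketed v c
  internal-bracketed c v cv ¬leaf below with internal c ¬leaf
  ... | (P , 𝒫P , P≈) with Merge.merge c 𝒫P P≈ (λ w → Adj T c w × w ≢ v) (other-neighbour? c v) proj₁ below (allFin m)
  ...   | inj₂ none = let (w , cw , w≢v) = another-element (T c) ¬leaf v
                      in ⊥-elim (none w (∈-allFin w) (cw , w≢v))
  ...   | inj₁ (B , valid , _ , spec) = B , valid , λ a → ⇔-trans (spec a) (split-at-node c v cv ¬leaf a)

  -- Termination: the recursion follows a path c, v, … of distinct nodes,
  -- which has at most m nodes; fuel + length ≥ m bounds its growth.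
  Budget : Fin m → Fin m → ℕ → Set
  Budget c v fuel = Σ[ vs ∈ List (Fin m) ] (Unique (c ∷ v ∷ vs) × Linked (Adj T) (c ∷ v ∷ vs)
                                            × m ≤ fuel + length (c ∷ v ∷ vs))

  extend-path : ∀ {c v vs w} → Unique (c ∷ v ∷ vs) → Linked (Adj T) (c ∷ v ∷ vs) → Adj T c w → w ≢ v
                → Unique (w ∷ c ∷ v ∷ vs)
  extend-path distinct linked cw w≢v = (neighbour≢ cw ∷ ¬Any⇒All¬ _ (off-path distinct linked cw w≢v)) ∷ distinct

  extend-budget : ∀ {c v w fuel} → Budget c v (suc fuel) → Adj T c w → w ≢ v → Budget w c fuel
  extend-budget {c} {v} {w} {fuel} (vs , distinct , linked , m≤) cw w≢v =
    v ∷ vs , extend-path distinct linked cw w≢v , (T-sym c w cw ∷ linked) ,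
    subst (m ≤_) (sym (ℕₚ.+-suc fuel (length (c ∷ v ∷ vs)))) m≤

  budget-exhausted : ∀ {c v w} → Budget c v 0 → Adj T c w → w ≢ v → ⊥
  budget-exhausted {c} {v} {w} (vs , distinct , linked , m≤) cw w≢v =
    ℕₚ.<-irrefl refl (ℕₚ.≤-trans (s≤s m≤) (unique-length≤ (w ∷ c ∷ v ∷ vs) (extend-path distinct linked cw w≢v)))

  initial-budget : ∀ r w → Adj T r w → Budget w r m
  initial-budget r w rw = [] , ((neighbour≢ rw ∷ []) ∷ ([] ∷ [])) , (T-sym r w rw ∷ [-]) , ℕₚ.m≤m+n m 2

  bracket-below : ∀ fuel c v → Adj T c v → Budget c v fuel → Bracketed v c
  bracket-below fuel c v cv budget with degree T c ≤? 1
  ... | yes c-leaf = leaf-bracketed c v cv c-leaf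
  ... | no ¬leaf   = internal-bracketed c v cv ¬leaf (bracket-other fuel budget)
    where
    bracket-other : ∀ f → Budget c v f → ∀ w → Adj T c w × w ≢ v → Bracketed c w
    bracket-other zero    b w (cw , w≢v) = ⊥-elim (budget-exhausted b cw w≢v)
    bracket-other (suc f) b w (cw , w≢v) = bracket-below f w c (T-sym c w cw) (extend-budget b cw w≢v)

  beyond : ∀ r w → Adj T r w → Bracketed r w
  beyond r w rw = bracket-below m w r (T-sym r w rw) (initial-budget r w rw)

  Covering : Set₁
  Covering = Σ[ B ∈ Bracketing n ] (ValidBelowTop B × (∀ a → a ∈ ⋃B B))

  from-internal-root : ∀ r → ¬ IsLeaf T r → Covering
  from-internal-root r ¬leaf with internal r ¬leaf
  ... | (P , 𝒫P , P≈) with Merge.merge r 𝒫P P≈ (Adj T r) (λ w → w Subₚ.∈? T r) id (beyond r) (allFin m)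
  ...   | inj₂ none = let (w , rw , _) = another-element (T r) ¬leaf r in ⊥-elim (none w (∈-allFin w) rw)
  ...   | inj₁ (B , valid , _ , spec) = B , Valid⇒ValidBelowTop B valid , covers
    where
    covers : ∀ a → a ∈ ⋃B B
    covers a with below-some-neighbour r a
    ... | inj₁ (_ , r-leaf) = ⊥-elim (¬leaf r-leaf)
    ... | inj₂ through      = from (spec a) through

  -- Rooting T at a leaf r without neighbours: T is the single node r.
  from-isolated-root : ∀ r → IsLeaf T r → (∀ w → ¬ Adj T r w) → Covering
  from-isolated-root r r-leaf isolated =
    leaf (τ r) , (leaves-in-𝒮 r r-leaf , SC3 (τ r) (leaves-in-𝒮 r r-leaf)) , covers
    where
    covers : ∀ a → a ∈ τ r
    covers a with below-some-neighbour r a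
    ... | inj₁ (a∈ , _)         = a∈
    ... | inj₂ (w , _ , rw , _) = ⊥-elim (isolated w rw)

  -- Rooting T at a leaf r with neighbour w: add the leaf τ r to the
  -- bracketing beyond w, unless τ r (a block of the leaf partition, like
  -- those below w) is already covered by it.
  from-leaf-root : ∀ r w → IsLeaf T r → Adj T r w → Covering
  from-leaf-root r w r-leaf rw =
    combine (block-inside-or-disjoint leaves-partition (r , r-leaf , refl) leaf-blocks)
    where
    Bw : Bracketing n
    Bw = proj₁ (beyond r w rw)
    valid-w : Valid Bw
    valid-w = proj₁ (proj₂ (beyond r w rw))
    spec-w : ∀ a → a ∈ ⋃B Bw ⇔ Below r w a
    spec-w = proj₂ (proj₂ (beyond r w rw))
    leaf-blocks : UnionOfBlocks (leafImage T τ) (⋃B Bw)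
    leaf-blocks a a∈ = let (ℓ , ℓ-leaf , walk , a∈ℓ) = to (spec-w a) a∈
                       in τ ℓ , (ℓ , ℓ-leaf , refl) , a∈ℓ , λ {b} b∈ℓ → from (spec-w b) (ℓ , ℓ-leaf , walk , b∈ℓ)
    splits : ∀ a → a ∈ τ r ⊎ a ∈ ⋃B Bw
    splits a with below-some-neighbour r a
    ... | inj₁ (a∈ , _) = inj₁ a∈
    ... | inj₂ (w′ , _ , rw′ , below) with at-most-one r-leaf rw rw′
    ...   | refl = inj₂ (from (spec-w a) below)
    combine : τ r ⊆ ⋃B Bw ⊎ Disjoint (τ r) (⋃B Bw) → Covering
    combine (inj₁ r⊆w)      = Bw , Valid⇒ValidBelowTop Bw valid-w , λ a → [ (λ a∈ → r⊆w a∈) , id ]′ (splits a)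
    combine (inj₂ disjoint) =
      node (leaf (τ r)) Bw , ((leaves-in-𝒮 r r-leaf , SC3 (τ r) (leaves-in-𝒮 r r-leaf)) , valid-w , disjoint) ,
      λ a → Subₚ.x∈p∪q⁺ (splits a)

  from-root : Fin m → Covering
  from-root r with degree T r ≤? 1
  ... | no ¬leaf   = from-internal-root r ¬leaf
  ... | yes r-leaf with any? (λ w → w Subₚ.∈? T r)
  ...   | no isolated  = from-isolated-root r r-leaf λ w rw → isolated (w , rw)
  ...   | yes (w , rw) = from-leaf-root r w r-leaf rw

  covering : Covering
  covering = from-root (some-node (proj₁ tree))
    where
    some-node : ∀ {k} → 1 ≤ k → Fin k
    some-node {suc k} _ = zero

theorem4 : (n : ℕ) → 1 ≤ n → (𝒫 : Family n → Set) → (𝒮 : Subset n → Set)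
    → IsScenario 𝒫 𝒮 → TreeDecomposition 𝒫 𝒮 → BranchDecomposition 𝒫 𝒮
theorem4 n _ 𝒫 𝒮 scenario td =
  let (B , valid , covers) = FromTreeDecomposition.covering scenario td
  in Scenario.branch-decomposition 𝒫 𝒮 B valid covers
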